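{- Let $t\ge2$, $n\ge1$ and let $\lambda$ be a partition with $\ell(\lambda)\le tn$. Then the $t$-core of $\lambda$ is self-conjugate if and only if $n_i(\lambda,tn)+n_{t-1-i}(\lambda,tn)=2n$ for all $0\le i\le\lfloor (t-1)/2\rfloor$.
   Context: For a partition $\lambda$ with $\ell(\lambda)\le m$, its beta set is $\beta(\lambda,m)=(\lambda_j+m-j)_{j=1}^m$ and $n_i(\lambda,m)$ is the number of its entries congruent to $i$ mod $t$. The $t$-core of $\lambda$ is the partition obtained by successively removing border strips (connected skew shapes with no $2\times2$ square) of size $t$ until none can be removed; it is independent of choices. Self-conjugate means equal to its conjugate. -}

module Defs where

open import Data.Nat using (ℕ; zero; suc; _+_; _*_; _∸_; _≤_; _<_; _≥_; _<?_)
open import Data.Nat.DivMod using (_%_)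
open import Data.Nat.Base using (NonZero)
open import Data.List using (List; []; _∷_; length; map; filter; upTo)
open import Data.Nat.ListAction using (sum)
open import Data.List.Relation.Unary.All using (All)
open import Data.List.Relation.Unary.Linked using (Linked)
open import Data.Product using (_×_; _,_)
open import Data.Sum using (_⊎_)
open import Relation.Nullary using (¬_)
open import Relation.Binary.PropositionalEquality using (_≡_)
open import Relation.Binary.Construct.Closure.ReflexiveTransitive using (Star)
open import Data.Nat using (_≟_)

Partition : Set
Partition = List ℕ

IsPartition : Partition → Set
IsPartition λ′ = Linked _≥_ λ′ × All (0 <_) λ′

len : Partition → ℕ
len = length

size : Partition → ℕ
size = sum

-- i-th part (0-indexed), 0 beyond the length
part : Partition → ℕ → ℕ
part []       _       = 0
part (x ∷ _)  zero    = x
part (_ ∷ xs) (suc i) = part xs i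

firstPart : Partition → ℕ
firstPart []      = 0
firstPart (x ∷ _) = x

conjugate : Partition → Partition
conjugate λ′ = map (λ j → length (filter (j <?_) λ′)) (upTo (firstPart λ′))

SelfConjugate : Partition → Set
SelfConjugate λ′ = conjugate λ′ ≡ λ′

-- Young diagram cells (row, column), 0-indexed
Cell : Set
Cell = ℕ × ℕ

InDiagram : Partition → Cell → Set
InDiagram λ′ (i , j) = j < part λ′ i

InSkew : Partition → Partition → Cell → Set
InSkew λ′ μ c = InDiagram λ′ c × ¬ InDiagram μ c

Adjacent : Cell → Cell → Set
Adjacent (i , j) (i′ , j′) =
  (i ≡ i′ × (suc j ≡ j′ ⊎ j ≡ suc j′)) ⊎ (j ≡ j′ × (suc i ≡ i′ ⊎ i ≡ suc i′))

Connected : (Cell → Set) → Set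
Connected S = ∀ a b → S a → S b →
  Star (λ x y → S x × S y × Adjacent x y) a b

No2x2 : (Cell → Set) → Set
No2x2 S = ∀ i j → ¬ (S (i , j) × S (suc i , j) × S (i , suc j) × S (suc i , suc j))

Contained : Partition → Partition → Set
Contained μ λ′ = ∀ i → part μ i ≤ part λ′ i

RemoveStrip : ℕ → Partition → Partition → Set
RemoveStrip t λ′ μ =
  IsPartition μ × Contained μ λ′ × size λ′ ≡ size μ + t ×
  Connected (InSkew λ′ μ) × No2x2 (InSkew λ′ μ)

IsCoreOf : ℕ → Partition → Partition → Set
IsCoreOf t λ′ κ =
  Star (RemoveStrip t) λ′ κ × (∀ ν → ¬ RemoveStrip t κ ν)

-- beta set β(λ,m) = (λ_j + m - j)_{j=1..m}; here 0-indexed: λ_j + m - 1 - j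
betaSet : Partition → ℕ → List ℕ
betaSet λ′ m = map (λ j → part λ′ j + (m ∸ suc j)) (upTo m)

nCount : (t : ℕ) → .{{NonZero t}} → ℕ → Partition → ℕ → ℕ
nCount t i λ′ m = length (filter (λ b → (b % t) ≟ i) (betaSet λ′ m))

{-# OPTIONS --safe #-}
-- Put λ on an abacus with m = t n beads, at the positions of its β-numbers. Removing a border strip of
-- size t slides one bead t places down its runner, so the counts n_i agree for λ and its t-core κ, and
-- since no strip can be removed from κ, every runner of κ is filled from the bottom without gaps.
-- A partition with at most m parts is self-conjugate iff its bead set is its own complement reflected
-- in the window [0, 2m). That reflection sends level k of runner i to level 2n - 1 - k of runner
-- t - 1 - i; for flush runners it is therefore a complement exactly when n_i + n_(t-1-i) = 2n.

module Submission where

open import Data.Nat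
open import Data.Nat.Properties
open import Data.Nat.DivMod using (m≡m%n+[m/n]*n; [m+n]%n≡m%n; [m+kn]%n≡m%n; m<n⇒m%n≡m; m/n≤m; m<n*o⇒m/o<n; m%n<n)
open import Data.Nat.Solver using (module +-*-Solver)
open import Data.List using (List; []; _∷_; length; filter; applyUpTo)
open import Data.List.Properties using (length-applyUpTo; map-applyUpTo)
open import Data.List.Relation.Unary.All using (All; []; _∷_)
open import Data.List.Relation.Unary.All.Properties using (applyUpTo⁺₁)
open import Data.List.Relation.Unary.Linked using (Linked; []; [-]; _∷_)
open import Data.Product using (_×_; _,_; ∃-syntax; proj₁; proj₂)
open import Data.Sum using (_⊎_; inj₁; inj₂)
open import Data.Empty using (⊥; ⊥-elim)
open import Function.Base using (_∘_)
open import Function.Bundles using (_⇔_; mk⇔; Equivalence)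
open import Function.Properties.Equivalence using () renaming (sym to ⇔-sym)
open import Relation.Nullary using (¬_; Dec; yes; no)
open import Relation.Unary using (Pred; Decidable)
open import Relation.Binary.Definitions using (tri<; tri≈; tri>)
open import Relation.Binary.PropositionalEquality
open import Relation.Binary.Construct.Closure.ReflexiveTransitive using (Star; ε; _◅_; _◅◅_; reverse)
open import Defs

open +-*-Solver
open Equivalence using (to; from)

𝟙 : ∀ {a} {A : Set a} → Dec A → ℕ
𝟙 (yes _) = 1
𝟙 (no _)  = 0

𝟙≤1 : ∀ {a} {A : Set a} (d : Dec A) → 𝟙 d ≤ 1
𝟙≤1 (yes _) = ≤-refl
𝟙≤1 (no _)  = z≤n

𝟙-yes : ∀ {a} {A : Set a} (d : Dec A) → A → 𝟙 d ≡ 1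
𝟙-yes (yes _) _ = refl
𝟙-yes (no ¬a) a = ⊥-elim (¬a a)

𝟙-no : ∀ {a} {A : Set a} (d : Dec A) → ¬ A → 𝟙 d ≡ 0
𝟙-no (yes a) ¬a = ⊥-elim (¬a a)
𝟙-no (no _)  _  = refl

𝟙-pos⇒ : ∀ {a} {A : Set a} (d : Dec A) → 0 < 𝟙 d → A
𝟙-pos⇒ (yes a) _  = a
𝟙-pos⇒ (no _)  ()

𝟙-cong : ∀ {a b} {A : Set a} {B : Set b} (d : Dec A) (e : Dec B) → A ⇔ B → 𝟙 d ≡ 𝟙 e
𝟙-cong (yes _) (yes _) _   = refl
𝟙-cong (yes a) (no ¬b) A⇔B = ⊥-elim (¬b (to A⇔B a))
𝟙-cong (no ¬a) (yes b) A⇔B = ⊥-elim (¬a (from A⇔B b))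
𝟙-cong (no _)  (no _)  _   = refl

∑< : ℕ → (ℕ → ℕ) → ℕ
∑< zero    f = 0
∑< (suc m) f = f 0 + ∑< m (f ∘ suc)

syntax ∑< m (λ p → e) = ∑[ p < m ] e

∑-cong : ∀ m {f g : ℕ → ℕ} → (∀ p → p < m → f p ≡ g p) → ∑< m f ≡ ∑< m g
∑-cong zero    _   = refl
∑-cong (suc m) f≡g = cong₂ _+_ (f≡g 0 z<s) (∑-cong m (λ p p<m → f≡g (suc p) (s<s p<m)))

∑-zero : ∀ m {f : ℕ → ℕ} → (∀ p → p < m → f p ≡ 0) → ∑< m f ≡ 0
∑-zero zero    _   = refl
∑-zero (suc m) f≡0 rewrite f≡0 0 z<s = ∑-zero m (λ p p<m → f≡0 (suc p) (s<s p<m))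

∑-one : ∀ m → ∑[ _ < m ] 1 ≡ m
∑-one zero    = refl
∑-one (suc m) = cong suc (∑-one m)

∑-split : ∀ a b (f : ℕ → ℕ) → ∑< (a + b) f ≡ ∑< a f + ∑[ p < b ] f (a + p)
∑-split zero    b f = refl
∑-split (suc a) b f = trans (cong (f 0 +_) (∑-split a b (f ∘ suc))) (sym (+-assoc (f 0) _ _))

∑-last : ∀ m (f : ℕ → ℕ) → ∑< (suc m) f ≡ ∑< m f + f m
∑-last m f = begin
  ∑< (suc m) f                 ≡⟨ cong (λ k → ∑< k f) (+-comm 1 m) ⟩
  ∑< (m + 1) f                 ≡⟨ ∑-split m 1 f ⟩
  ∑< m f + (f (m + 0) + 0)     ≡⟨ cong (λ v → ∑< m f + v) (trans (+-identityʳ _) (cong f (+-identityʳ m))) ⟩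
  ∑< m f + f m                 ∎
  where open ≡-Reasoning

∑-distrib-+ : ∀ m (f g : ℕ → ℕ) → ∑[ p < m ] (f p + g p) ≡ ∑< m f + ∑< m g
∑-distrib-+ zero    f g = refl
∑-distrib-+ (suc m) f g rewrite ∑-distrib-+ m (f ∘ suc) (g ∘ suc) =
  solve 4 (λ a b c d → (a :+ b) :+ (c :+ d) := (a :+ c) :+ (b :+ d)) refl (f 0) (g 0) _ _

∑-mono-≤ : ∀ m {f g : ℕ → ℕ} → (∀ p → p < m → f p ≤ g p) → ∑< m f ≤ ∑< m g
∑-mono-≤ zero    _   = z≤n
∑-mono-≤ (suc m) f≤g = +-mono-≤ (f≤g 0 z<s) (∑-mono-≤ m (λ p p<m → f≤g (suc p) (s<s p<m)))

term≤∑ : ∀ m (f : ℕ → ℕ) {p} → p < m → f p ≤ ∑< m f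
term≤∑ (suc m) f {zero}  _         = m≤m+n (f 0) _
term≤∑ (suc m) f {suc p} (s<s p<m) = ≤-trans (term≤∑ m (f ∘ suc) p<m) (m≤n+m _ (f 0))

∑-<⇒ : ∀ m (f g : ℕ → ℕ) → ∑< m f < ∑< m g → ∃[ p ] p < m × f p < g p
∑-<⇒ (suc m) f g ∑f<∑g with f 0 <? g 0
... | yes f0<g0 = 0 , z<s , f0<g0
... | no  f0≮g0 with ∑-<⇒ m (f ∘ suc) (g ∘ suc)
                      (+-cancelˡ-< (g 0) _ _ (≤-<-trans (+-monoˡ-≤ _ (≮⇒≥ f0≮g0)) ∑f<∑g))
...   | p , p<m , fp<gp = suc p , s<s p<m , fp<gp

∑-reverse : ∀ m (f : ℕ → ℕ) → ∑< m f ≡ ∑[ p < m ] f (m ∸ suc p)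
∑-reverse zero    f = refl
∑-reverse (suc m) f = begin
  f 0 + ∑< m (f ∘ suc)                             ≡⟨ cong (f 0 +_) (∑-reverse m (f ∘ suc)) ⟩
  f 0 + ∑[ p < m ] f (suc (m ∸ suc p))             ≡⟨ +-comm (f 0) _ ⟩
  ∑[ p < m ] f (suc (m ∸ suc p)) + f 0             ≡⟨ cong₂ _+_ (∑-cong m (λ p p<m → cong f (sym (+-∸-assoc 1 p<m))))
                                                               (cong f (sym (n∸n≡0 m))) ⟩
  ∑[ p < m ] f (suc m ∸ suc p) + f (suc m ∸ suc m) ≡⟨ sym (∑-last m (λ p → f (suc m ∸ suc p))) ⟩
  ∑[ p < suc m ] f (suc m ∸ suc p)                 ∎
  where open ≡-Reasoning

∑-comm : ∀ a b (h : ℕ → ℕ → ℕ) → ∑[ p < a ] ∑[ k < b ] h p k ≡ ∑[ k < b ] ∑[ p < a ] h p k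
∑-comm zero    b h = sym (∑-zero b (λ _ _ → refl))
∑-comm (suc a) b h = begin
  ∑[ k < b ] h 0 k + ∑[ p < a ] ∑[ k < b ] h (suc p) k ≡⟨ cong (∑[ k < b ] h 0 k +_) (∑-comm a b (h ∘ suc)) ⟩
  ∑[ k < b ] h 0 k + ∑[ k < b ] ∑[ p < a ] h (suc p) k ≡⟨ sym (∑-distrib-+ b (h 0) _) ⟩
  ∑[ k < b ] ∑[ p < suc a ] h p k                     ∎
  where open ≡-Reasoning

∑-rotate : ∀ m {r s} (f g : ℕ → ℕ) → r ≤ s → s < m →
           (∀ p → p < r ⊎ s < p → g p ≡ f p) → (∀ p → r ≤ p → p < s → g p ≡ f (suc p)) →
           ∑< m f + g s ≡ ∑< m g + f r
∑-rotate (suc m) {zero} {zero} f g _ _ outside _ = begin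
  f 0 + ∑< m (f ∘ suc) + g 0 ≡⟨ cong (λ v → f 0 + v + g 0) (∑-cong m (λ p _ → sym (outside (suc p) (inj₂ z<s)))) ⟩
  f 0 + ∑< m (g ∘ suc) + g 0 ≡⟨ solve 3 (λ a b c → a :+ b :+ c := c :+ b :+ a) refl (f 0) _ (g 0) ⟩
  g 0 + ∑< m (g ∘ suc) + f 0 ∎
  where open ≡-Reasoning
∑-rotate (suc m) {zero} {suc s} f g _ (s<s s<m) outside inside = begin
  f 0 + ∑< m (f ∘ suc) + g (suc s)   ≡⟨ +-assoc (f 0) _ _ ⟩
  f 0 + (∑< m (f ∘ suc) + g (suc s)) ≡⟨ cong (f 0 +_) (∑-rotate m (f ∘ suc) (g ∘ suc) z≤n s<m
                                          (λ { p (inj₂ s<p) → outside (suc p) (inj₂ (s<s s<p)) })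
                                          (λ p _ p<s → inside (suc p) z≤n (s<s p<s))) ⟩
  f 0 + (∑< m (g ∘ suc) + f 1)       ≡⟨ cong (λ v → f 0 + (∑< m (g ∘ suc) + v)) (sym (inside 0 z≤n z<s)) ⟩
  f 0 + (∑< m (g ∘ suc) + g 0)       ≡⟨ solve 3 (λ a b c → a :+ (b :+ c) := c :+ b :+ a) refl (f 0) _ (g 0) ⟩
  g 0 + ∑< m (g ∘ suc) + f 0         ∎
  where open ≡-Reasoning
∑-rotate (suc m) {suc r} {suc s} f g (s≤s r≤s) (s<s s<m) outside inside = begin
  f 0 + ∑< m (f ∘ suc) + g (suc s)   ≡⟨ +-assoc (f 0) _ _ ⟩
  f 0 + (∑< m (f ∘ suc) + g (suc s)) ≡⟨ cong₂ _+_ (sym (outside 0 (inj₁ z<s)))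
                                          (∑-rotate m (f ∘ suc) (g ∘ suc) r≤s s<m
                                            (λ { p (inj₁ p<r) → outside (suc p) (inj₁ (s<s p<r))
                                               ; p (inj₂ s<p) → outside (suc p) (inj₂ (s<s s<p)) })
                                            (λ p r≤p p<s → inside (suc p) (s≤s r≤p) (s<s p<s))) ⟩
  g 0 + (∑< m (g ∘ suc) + f (suc r)) ≡⟨ sym (+-assoc (g 0) _ _) ⟩
  g 0 + ∑< m (g ∘ suc) + f (suc r)   ∎
  where open ≡-Reasoning

≡-from-<⇔ : ∀ a b → (∀ p → p < a ⇔ p < b) → a ≡ b
≡-from-<⇔ a b same with <-cmp a b
... | tri< a<b _ _ = ⊥-elim (<-irrefl refl (from (same a) a<b))
... | tri≈ _ a≡b _ = a≡b
... | tri> _ _ b<a = ⊥-elim (<-irrefl refl (to (same b) b<a))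

<∑𝟙⇔ : ∀ L {P : ℕ → Set} (P? : ∀ p → Dec (P p)) → (∀ p → P (suc p) → P p) → (∀ p → L ≤ p → ¬ P p) →
       ∀ p → p < ∑[ q < L ] 𝟙 (P? q) ⇔ P p
<∑𝟙⇔ zero    P? down bound p = mk⇔ (λ ()) (⊥-elim ∘ bound p z≤n)
<∑𝟙⇔ (suc L) {P} P? down bound p with P? 0
... | no ¬P0 = mk⇔ (λ p<0 → ⊥-elim (n≮0 (subst (p <_) count≡0 p<0))) (λ Pp → ⊥-elim (¬P0 (P0 p Pp)))
  where
  P0 : ∀ p → P p → P 0
  P0 zero    Pp = Pp
  P0 (suc p) Pp = P0 p (down p Pp)
  count≡0 : ∑[ q < L ] 𝟙 (P? (suc q)) ≡ 0
  count≡0 = ∑-zero L (λ q _ → 𝟙-no (P? (suc q)) (¬P0 ∘ P0 (suc q)))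
... | yes P0 with p
...   | zero   = mk⇔ (λ _ → P0) (λ _ → z<s)
...   | suc p′ = mk⇔ (to shifted ∘ ≤-pred) (s≤s ∘ from shifted)
  where
  shifted : p′ < ∑[ q < L ] 𝟙 (P? (suc q)) ⇔ P (suc p′)
  shifted = <∑𝟙⇔ L (P? ∘ suc) (down ∘ suc) (λ q L≤q → bound (suc q) (s≤s L≤q)) p′

∑𝟙-<? : ∀ K c → c ≤ K → ∑[ k < K ] 𝟙 (k <? c) ≡ c
∑𝟙-<? K c c≤K = ≡-from-<⇔ _ c (<∑𝟙⇔ K (_<? c) (λ _ → <-trans (n<1+n _))
                                  (λ p K≤p p<c → <-irrefl refl (<-≤-trans p<c (≤-trans c≤K K≤p))))

∑𝟙-≟ : ∀ K k₀ → k₀ < K → ∑[ k < K ] 𝟙 (k ≟ k₀) ≡ 1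
∑𝟙-≟ (suc K) zero     _         = cong suc (∑-zero K (λ _ _ → refl))
∑𝟙-≟ (suc K) (suc k₀) (s<s k₀<K) =
  trans (∑-cong K (λ p _ → 𝟙-cong (suc p ≟ suc k₀) (p ≟ k₀) (mk⇔ suc-injective (cong suc)))) (∑𝟙-≟ K k₀ k₀<K)

∑𝟙≟-≤1 : ∀ m (f : ℕ → ℕ) x → (∀ {p q} → p < q → q < m → f q < f p) → ∑[ p < m ] 𝟙 (f p ≟ x) ≤ 1
∑𝟙≟-≤1 zero    f x _  = z≤n
∑𝟙≟-≤1 (suc m) f x f↓ with f 0 ≟ x
... | no  _    = ∑𝟙≟-≤1 m (f ∘ suc) x (λ p<q q<m → f↓ (s<s p<q) (s<s q<m))
... | yes f0≡x = s≤s (≤-reflexive (∑-zero m (λ p p<m → 𝟙-no (f (suc p) ≟ x)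
                                       (λ fp≡x → <-irrefl (trans fp≡x (sym f0≡x)) (f↓ z<s (s<s p<m))))))

𝟙-<-suc : ∀ X v → 𝟙 (X <? v) ≡ 𝟙 (v ≟ suc X) + 𝟙 (suc X <? v)
𝟙-<-suc X v with <-cmp v (suc X)
... | tri< v<X+1 _ _ = trans (𝟙-no (X <? v) (<⇒≱ v<X+1))
                             (sym (cong₂ _+_ (𝟙-no (v ≟ suc X) (<⇒≢ v<X+1)) (𝟙-no (suc X <? v) (<-asym v<X+1))))
... | tri≈ _ refl _   = trans (𝟙-yes (X <? v) ≤-refl)
                             (sym (cong₂ _+_ (𝟙-yes (v ≟ suc X) refl) (𝟙-no (suc X <? v) (<-irrefl refl))))
... | tri> _ _ X+1<v = trans (𝟙-yes (X <? v) (<-trans (n<1+n X) X+1<v))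
                             (sym (cong₂ _+_ (𝟙-no (v ≟ suc X) (>⇒≢ X+1<v)) (𝟙-yes (suc X <? v) X+1<v)))

𝟙-≟0 : ∀ v → 1 ≡ 𝟙 (v ≟ 0) + 𝟙 (0 <? v)
𝟙-≟0 zero    = refl
𝟙-≟0 (suc v) = refl

least : ∀ {P : ℕ → Set} (P? : ∀ p → Dec (P p)) a → P a → ∃[ r ] P r × r ≤ a × (∀ p → p < r → ¬ P p)
least     P? zero    Pa = 0 , Pa , z≤n , λ _ ()
least {P} P? (suc a) Pa with P? 0
... | yes P0 = 0 , P0 , z≤n , λ _ ()
... | no ¬P0 with least (P? ∘ suc) a Pa
...   | r , Pr , r≤a , below = suc r , Pr , s≤s r≤a , below′
  where
  below′ : ∀ p → p < suc r → ¬ P p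
  below′ zero    _         = ¬P0
  below′ (suc p) (s<s p<r) = below p p<r

greatest : ∀ {P : ℕ → Set} (P? : ∀ p → Dec (P p)) k {a} → P a → (∀ p → k ≤ p → ¬ P p) →
           ∃[ s ] P s × a ≤ s × (∀ p → s < p → ¬ P p)
greatest     P? zero    {a} Pa bound = ⊥-elim (bound a z≤n Pa)
greatest {P} P? (suc k) {a} Pa bound with P? k
... | yes Pk = k , Pk , ≮⇒≥ (λ k<a → bound a k<a Pa) , bound
... | no ¬Pk = greatest P? k Pa bound′
  where
  bound′ : ∀ p → k ≤ p → ¬ P p
  bound′ p k≤p with k ≟ p
  ... | yes refl = ¬Pk
  ... | no  k≢p  = bound p (≤∧≢⇒< k≤p k≢p)

stepwise-antitone : ∀ {f : ℕ → ℕ} → (∀ p → f (suc p) ≤ f p) → ∀ {p q} → p ≤ q → f q ≤ f p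
stepwise-antitone f↓ {q = zero}  z≤n  = ≤-refl
stepwise-antitone f↓ {p} {suc q} p≤1+q with m≤n⇒m<n∨m≡n p≤1+q
... | inj₁ (s≤s p≤q) = ≤-trans (f↓ q) (stepwise-antitone f↓ p≤q)
... | inj₂ refl      = ≤-refl

part-suc≤ : ∀ {xs} → Linked _≥_ xs → ∀ p → part xs (suc p) ≤ part xs p
part-suc≤ []        _       = z≤n
part-suc≤ [-]       _       = z≤n
part-suc≤ (x≥y ∷ _) zero    = x≥y
part-suc≤ (_ ∷ l)   (suc p) = part-suc≤ l p

part-antitone : ∀ {xs} → Linked _≥_ xs → ∀ {p q} → p ≤ q → part xs q ≤ part xs p
part-antitone l = stepwise-antitone (part-suc≤ l)

part-≥length : ∀ xs {p} → length xs ≤ p → part xs p ≡ 0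
part-≥length []       _           = refl
part-≥length (_ ∷ xs) (s≤s len≤p) = part-≥length xs len≤p

part-<length : ∀ {xs} → All (0 <_) xs → ∀ {p} → p < length xs → 0 < part xs p
part-<length (x>0 ∷ _)  {zero}  _           = x>0
part-<length (_ ∷ xs>0) {suc p} (s<s p<len) = part-<length xs>0 p<len

length≤ : ∀ {xs} → All (0 <_) xs → ∀ {p} → part xs p ≡ 0 → length xs ≤ p
length≤ xs>0 part≡0 = ≮⇒≥ (λ p<len → <-irrefl (sym part≡0) (part-<length xs>0 p<len))

∑-part : ∀ xs {L} → length xs ≤ L → ∑< L (part xs) ≡ size xs
∑-part xs {L} len≤L with m≤n⇒∃[o]m+o≡n len≤L
... | k , refl = begin
  ∑< (length xs + k) (part xs)                               ≡⟨ ∑-split (length xs) k (part xs) ⟩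
  ∑< (length xs) (part xs) + ∑[ p < k ] part xs (length xs + p) ≡⟨ cong (∑< (length xs) (part xs) +_)
                                                                     (∑-zero k (λ p _ → part-≥length xs (m≤m+n _ p))) ⟩
  ∑< (length xs) (part xs) + 0                               ≡⟨ +-identityʳ _ ⟩
  ∑< (length xs) (part xs)                                   ≡⟨ whole xs ⟩
  size xs                                                    ∎
  where
  open ≡-Reasoning
  whole : ∀ xs → ∑< (length xs) (part xs) ≡ size xs
  whole []       = refl
  whole (x ∷ xs) = cong (x +_) (whole xs)

part-applyUpTo : ∀ (f : ℕ → ℕ) K {q} → q < K → part (applyUpTo f K) q ≡ f q
part-applyUpTo f (suc K) {zero}  _         = refl
part-applyUpTo f (suc K) {suc q} (s<s q<K) = part-applyUpTo (f ∘ suc) K q<K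

part-applyUpTo-≥ : ∀ (f : ℕ → ℕ) K {q} → K ≤ q → part (applyUpTo f K) q ≡ 0
part-applyUpTo-≥ f zero    _         = refl
part-applyUpTo-≥ f (suc K) (s≤s K≤q) = part-applyUpTo-≥ (f ∘ suc) K K≤q

part-injective : ∀ {xs ys} → All (0 <_) xs → All (0 <_) ys → (∀ p → part xs p ≡ part ys p) → xs ≡ ys
part-injective []         []         _    = refl
part-injective []         (y>0 ∷ _)  same = ⊥-elim (<-irrefl (same 0) y>0)
part-injective (x>0 ∷ _)  []         same = ⊥-elim (<-irrefl (sym (same 0)) x>0)
part-injective (_ ∷ xs>0) (_ ∷ ys>0) same = cong₂ _∷_ (same 0) (part-injective xs>0 ys>0 (same ∘ suc))

length-filter-∷ : ∀ {p} {P : Pred ℕ p} (P? : Decidable P) x xs →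
                  length (filter P? (x ∷ xs)) ≡ 𝟙 (P? x) + length (filter P? xs)
length-filter-∷ P? x xs with P? x
... | yes _ = refl
... | no  _ = refl

length-filter : ∀ {p} {P : Pred ℕ p} (P? : Decidable P) xs →
                length (filter P? xs) ≡ ∑[ p < length xs ] 𝟙 (P? (part xs p))
length-filter P? []       = refl
length-filter P? (x ∷ xs) = trans (length-filter-∷ P? x xs) (cong (𝟙 (P? x) +_) (length-filter P? xs))

length-filter-applyUpTo : ∀ {p} {P : Pred ℕ p} (P? : Decidable P) (f : ℕ → ℕ) K →
                          length (filter P? (applyUpTo f K)) ≡ ∑[ q < K ] 𝟙 (P? (f q))
length-filter-applyUpTo P? f K = begin
  length (filter P? ys)                      ≡⟨ length-filter P? ys ⟩
  ∑[ q < length ys ] 𝟙 (P? (part ys q))      ≡⟨ cong (λ L → ∑[ q < L ] 𝟙 (P? (part ys q))) (length-applyUpTo f K) ⟩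
  ∑[ q < K ] 𝟙 (P? (part ys q))              ≡⟨ ∑-cong K (λ q q<K → cong (𝟙 ∘ P?) (part-applyUpTo f K q<K)) ⟩
  ∑[ q < K ] 𝟙 (P? (f q))                    ∎
  where
  open ≡-Reasoning
  ys : List ℕ
  ys = applyUpTo f K

conjugate-applyUpTo : ∀ xs → conjugate xs ≡ applyUpTo (λ q → length (filter (q <?_) xs)) (firstPart xs)
conjugate-applyUpTo xs = map-applyUpTo (λ q → q) _ (firstPart xs)

part-conjugate : ∀ {xs} → Linked _≥_ xs → ∀ q → part (conjugate xs) q ≡ ∑[ p < length xs ] 𝟙 (q <? part xs p)
part-conjugate {xs} l q rewrite conjugate-applyUpTo xs with q <? firstPart xs
... | yes q<λ₁ = trans (part-applyUpTo _ (firstPart xs) q<λ₁) (length-filter (q <?_) xs)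
... | no  q≮λ₁ = trans (part-applyUpTo-≥ _ (firstPart xs) (≮⇒≥ q≮λ₁))
                       (sym (∑-zero (length xs) λ p _ →
                              𝟙-no (q <? part xs p) (λ q<λₚ → q≮λ₁ (<-≤-trans q<λₚ (≤firstPart xs l p)))))
  where
  ≤firstPart : ∀ xs → Linked _≥_ xs → ∀ p → part xs p ≤ firstPart xs
  ≤firstPart []       _ _ = z≤n
  ≤firstPart (x ∷ xs) l p = part-antitone l {0} {p} z≤n

conjugate-positive : ∀ xs → All (0 <_) (conjugate xs)
conjugate-positive xs rewrite conjugate-applyUpTo xs = applyUpTo⁺₁ _ (firstPart xs) (positive xs)
  where
  positive : ∀ xs {q} → q < firstPart xs → 0 < length (filter (q <?_) xs)
  positive (x ∷ xs) {q} q<x rewrite length-filter-∷ (q <?_) x xs | 𝟙-yes (q <? x) q<x = z<s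

linked-from-part : ∀ xs → (∀ p → part xs (suc p) ≤ part xs p) → Linked _≥_ xs
linked-from-part []           _  = []
linked-from-part (x ∷ [])     _  = [-]
linked-from-part (x ∷ y ∷ xs) xs↓ = xs↓ 0 ∷ linked-from-part (y ∷ xs) (xs↓ ∘ suc)

fromParts : (ℕ → ℕ) → ℕ → Partition
fromParts f zero    = []
fromParts f (suc L) with f 0
... | zero  = []
... | suc v = suc v ∷ fromParts (f ∘ suc) L

part-fromParts : ∀ f L → (∀ p → f (suc p) ≤ f p) → (∀ p → L ≤ p → f p ≡ 0) →
                 ∀ p → part (fromParts f L) p ≡ f p
part-fromParts f zero    _  f≡0 p = sym (f≡0 p z≤n)
part-fromParts f (suc L) f↓ f≡0 p with f 0 in f0≡
... | zero  = sym (n≤0⇒n≡0 (≤-trans (stepwise-antitone f↓ z≤n) (≤-reflexive f0≡)))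
... | suc v with p
...   | zero   = sym f0≡
...   | suc p′ = part-fromParts (f ∘ suc) L (f↓ ∘ suc) (λ q L≤q → f≡0 (suc q) (s≤s L≤q)) p′

fromParts-positive : ∀ f L → All (0 <_) (fromParts f L)
fromParts-positive f zero    = []
fromParts-positive f (suc L) with f 0
... | zero  = []
... | suc v = z<s ∷ fromParts-positive (f ∘ suc) L

-- β xs m p is the (p+1)-st entry of the paper's β(λ, m): the position of bead p on the abacus.
β : Partition → ℕ → ℕ → ℕ
β xs m p = part xs p + (m ∸ suc p)

nCount≡∑ : ∀ t .{{_ : NonZero t}} i xs m → nCount t i xs m ≡ ∑[ p < m ] 𝟙 ((β xs m p % t) ≟ i)
nCount≡∑ t i xs m = trans (cong (length ∘ filter (λ b → (b % t) ≟ i)) (map-applyUpTo (λ p → p) (β xs m) m))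
                          (length-filter-applyUpTo (λ b → (b % t) ≟ i) (β xs m) m)

∑β : ∀ xs {m} → length xs ≤ m → ∑< m (β xs m) ≡ size xs + ∑[ p < m ] (m ∸ suc p)
∑β xs {m} len≤m = trans (∑-distrib-+ m (part xs) _) (cong (_+ _) (∑-part xs len≤m))

∸-suc : ∀ m p → p < m → m ∸ p ≡ suc (m ∸ suc p)
∸-suc (suc m) zero    _         = refl
∸-suc (suc m) (suc p) (s<s p<m) = ∸-suc m p p<m

-- On the abacus: bead r of xs moves down to become bead s of ys, and the beads in between are renumbered.
record MovesOneBead (m : ℕ) (xs ys : Partition) (r s : ℕ) : Set where
  field
    r≤s       : r ≤ s
    s<m       : s < m
    unchanged : ∀ p → p < r ⊎ s < p → part ys p ≡ part xs p
    shifted   : ∀ p → r ≤ p → p < s → suc (part ys p) ≡ part xs (suc p)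

module _ {m xs ys r s} (move : MovesOneBead m xs ys r s) where
  open MovesOneBead move

  β-unchanged : ∀ p → p < r ⊎ s < p → β ys m p ≡ β xs m p
  β-unchanged p p∉ = cong (_+ (m ∸ suc p)) (unchanged p p∉)

  β-shifted : ∀ p → r ≤ p → p < s → β ys m p ≡ β xs m (suc p)
  β-shifted p r≤p p<s = begin
    part ys p + (m ∸ suc p)              ≡⟨ cong (part ys p +_) (∸-suc m (suc p) (<-≤-trans (s≤s p<s) s<m)) ⟩
    part ys p + suc (m ∸ suc (suc p))    ≡⟨ +-suc (part ys p) _ ⟩
    suc (part ys p) + (m ∸ suc (suc p))  ≡⟨ cong (_+ (m ∸ suc (suc p))) (shifted p r≤p p<s) ⟩
    part xs (suc p) + (m ∸ suc (suc p))  ∎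
    where open ≡-Reasoning

  ∑∘β-rotate : ∀ (φ : ℕ → ℕ) →
               ∑[ p < m ] φ (β xs m p) + φ (β ys m s) ≡ ∑[ p < m ] φ (β ys m p) + φ (β xs m r)
  ∑∘β-rotate φ = ∑-rotate m (φ ∘ β xs m) (φ ∘ β ys m) r≤s s<m
                   (λ p p∉ → cong φ (β-unchanged p p∉)) (λ p r≤p p<s → cong φ (β-shifted p r≤p p<s))

  size-drop⇔bead-drop : length xs ≤ m → length ys ≤ m → ∀ t → size xs ≡ size ys + t ⇔ β xs m r ≡ β ys m s + t
  size-drop⇔bead-drop lenxs lenys t = arith (begin
    size xs + K + β ys m s      ≡⟨ cong (_+ β ys m s) (sym (∑β xs lenxs)) ⟩
    ∑< m (β xs m) + β ys m s    ≡⟨ ∑∘β-rotate (λ b → b) ⟩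
    ∑< m (β ys m) + β xs m r    ≡⟨ cong (_+ β xs m r) (∑β ys lenys) ⟩
    size ys + K + β xs m r      ∎)
    where
    open ≡-Reasoning
    K = ∑[ p < m ] (m ∸ suc p)
    arith : ∀ {A B a b} → A + K + b ≡ B + K + a → A ≡ B + t ⇔ a ≡ b + t
    arith {A} {B} {a} {b} rot = mk⇔
      (λ A≡ → +-cancelˡ-≡ (B + K) a (b + t) (sym (trans
                (solve 4 (λ B K b t → B :+ K :+ (b :+ t) := B :+ t :+ K :+ b) refl B K b t)
                (trans (cong (λ v → v + K + b) (sym A≡)) rot))))
      (λ a≡ → +-cancelʳ-≡ (K + b) A (B + t) (trans (sym (+-assoc A K b))
                (trans rot (trans (cong (B + K +_) a≡)
                  (solve 4 (λ B K b t → B :+ K :+ (b :+ t) := B :+ t :+ (K :+ b)) refl B K b t)))))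

  nCount-moves : ∀ t .{{_ : NonZero t}} → β xs m r ≡ β ys m s + t → ∀ i → nCount t i xs m ≡ nCount t i ys m
  nCount-moves t drop i = begin
    nCount t i xs m              ≡⟨ nCount≡∑ t i xs m ⟩
    ∑[ p < m ] φ (β xs m p)      ≡⟨ +-cancelʳ-≡ (φ (β ys m s)) _ _
                                      (trans (∑∘β-rotate φ) (cong (∑[ p < m ] φ (β ys m p) +_) φr≡φs)) ⟩
    ∑[ p < m ] φ (β ys m p)      ≡⟨ sym (nCount≡∑ t i ys m) ⟩
    nCount t i ys m              ∎
    where
    open ≡-Reasoning
    φ : ℕ → ℕ
    φ b = 𝟙 ((b % t) ≟ i)
    φr≡φs : φ (β xs m r) ≡ φ (β ys m s)
    φr≡φs = cong (λ v → 𝟙 (v ≟ i)) (trans (cong (_% t) drop) ([m+n]%n≡m%n (β ys m s) t))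

-- Border strips

SkewStep : Partition → Partition → Cell → Cell → Set
SkewStep xs ys a b = InSkew xs ys a × InSkew xs ys b × Adjacent a b

skew-step-stays-above : ∀ xs ys p → part xs (suc p) ≤ part ys p →
                        ∀ {a b} → SkewStep xs ys a b → proj₁ a ≤ p → proj₁ b ≤ p
skew-step-stays-above _ _ p _ (_ , _ , inj₁ (refl , _))         i≤p = i≤p
skew-step-stays-above _ _ p _ (_ , _ , inj₂ (_ , inj₂ refl))    i≤p = ≤-trans (n≤1+n _) i≤p
skew-step-stays-above _ _ p below≤ {i , j} ((_ , j≮ys) , (j<xs , _) , inj₂ (refl , inj₁ refl)) i≤p with i ≟ p
... | yes refl = ⊥-elim (j≮ys (<-≤-trans j<xs below≤))
... | no  i≢p  = ≤∧≢⇒< i≤p i≢p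

skew-path-stays-above : ∀ xs ys p → part xs (suc p) ≤ part ys p →
                        ∀ {a b} → Star (SkewStep xs ys) a b → proj₁ a ≤ p → proj₁ b ≤ p
skew-path-stays-above xs ys p below≤ ε            a≤p = a≤p
skew-path-stays-above xs ys p below≤ (step ◅ path) a≤p =
  skew-path-stays-above xs ys p below≤ path (skew-step-stays-above xs ys p below≤ step a≤p)

no2x2⇒row-bound : ∀ {xs ys} → Linked _≥_ xs → Linked _≥_ ys → No2x2 (InSkew xs ys) →
                  ∀ p → part xs (suc p) ≤ suc (part ys p)
no2x2⇒row-bound {xs} {ys} xs↓ ys↓ no2x2 p = ≮⇒≥ λ q+1<xs → no2x2 p q
  ( (≤-trans (<⇒≤ q+1<xs) (part-suc≤ xs↓ p) , <-irrefl refl)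
  , (<⇒≤ q+1<xs , λ q<ys₊ → <-irrefl refl (<-≤-trans q<ys₊ (part-suc≤ ys↓ p)))
  , (≤-trans q+1<xs (part-suc≤ xs↓ p) , λ q+1<ys → <-irrefl refl (<-trans q+1<ys (n<1+n q)))
  , (q+1<xs , λ q+1<ys₊ → <-irrefl refl (<-trans (<-≤-trans q+1<ys₊ (part-suc≤ ys↓ p)) (n<1+n q))) )
  where
  q : ℕ
  q = part ys p

length-contained : ∀ {m} xs {ys} → All (0 <_) ys → Contained ys xs → length xs ≤ m → length ys ≤ m
length-contained {m} xs ys>0 ys⊆xs len≤m =
  length≤ ys>0 (n≤0⇒n≡0 (≤-trans (ys⊆xs m) (≤-reflexive (part-≥length xs len≤m))))

module _ {t m xs ys} (t≥1 : 1 ≤ t) (xs↓ : Linked _≥_ xs) (len≤m : length xs ≤ m)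
         (ys-part : IsPartition ys) (ys⊆xs : Contained ys xs) (size≡ : size xs ≡ size ys + t)
         (connected : Connected (InSkew xs ys)) (no2x2 : No2x2 (InSkew xs ys)) where

  private
    F G : ℕ → ℕ
    F = part xs
    G = part ys

    InStrip : ℕ → Set
    InStrip p = G p < F p

    unchanged : ∀ p → ¬ InStrip p → G p ≡ F p
    unchanged p p∉ = ≤-antisym (ys⊆xs p) (≮⇒≥ p∉)

    some-row : ∃[ p ] p < m × InStrip p
    some-row = ∑-<⇒ m G F (begin-strict
      ∑< m G     <⟨ m<m+n (∑< m G) t≥1 ⟩
      ∑< m G + t ≡⟨ cong (_+ t) (∑-part ys (length-contained xs (proj₂ ys-part) ys⊆xs len≤m)) ⟩
      size ys + t ≡⟨ sym size≡ ⟩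
      size xs    ≡⟨ sym (∑-part xs len≤m) ⟩
      ∑< m F     ∎)
      where open ≤-Reasoning

    strip<m : ∀ p → InStrip p → p < m
    strip<m p p∈ = ≰⇒> λ m≤p → n≮0 (subst (G p <_) (part-≥length xs (≤-trans len≤m m≤p)) p∈)

    crossing : ∀ {r s} → InStrip r → InStrip s → ∀ p → r ≤ p → p < s → G p < F (suc p)
    crossing {r} {s} r∈ s∈ p r≤p p<s = ≰⇒> λ F₊≤G → <⇒≱ p<s
      (skew-path-stays-above xs ys p F₊≤G (connected (r , G r) (s , G s) (r∈ , <-irrefl refl) (s∈ , <-irrefl refl)) r≤p)

  -- The strip occupies the rows from the first to the last one where ys is shorter than xs.
  removeStrip⇒movesOneBead : ∃[ r ] ∃[ s ] MovesOneBead m xs ys r s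
  removeStrip⇒movesOneBead with some-row
  ... | p₀ , _ , p₀∈ with least (λ p → G p <? F p) p₀ p₀∈
                        | greatest (λ p → G p <? F p) m p₀∈ (λ p m≤p p∈ → <⇒≱ (strip<m p p∈) m≤p)
  ...   | r , r∈ , r≤p₀ , above | s , s∈ , p₀≤s , below = r , s , record
    { r≤s       = ≤-trans r≤p₀ p₀≤s
    ; s<m       = strip<m s s∈
    ; unchanged = λ { p (inj₁ p<r) → unchanged p (above p p<r) ; p (inj₂ s<p) → unchanged p (below p s<p) }
    ; shifted   = λ p r≤p p<s → ≤-antisym (crossing r∈ s∈ p r≤p p<s) (no2x2⇒row-bound xs↓ (proj₁ ys-part) no2x2 p)
    }

nCount-removeStrip : ∀ {t m xs ys} .{{_ : NonZero t}} → 1 ≤ t → IsPartition xs → length xs ≤ m →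
                     RemoveStrip t xs ys → ∀ i → nCount t i xs m ≡ nCount t i ys m
nCount-removeStrip {t} {xs = xs} t≥1 (xs↓ , _) len≤m (ys-part , ys⊆xs , size≡ , connected , no2x2)
  with removeStrip⇒movesOneBead t≥1 xs↓ len≤m ys-part ys⊆xs size≡ connected no2x2
... | _ , _ , move =
  nCount-moves move t (to (size-drop⇔bead-drop move len≤m (length-contained xs (proj₂ ys-part) ys⊆xs len≤m) t) size≡)

removeStrips-invariant : ∀ {t m xs κ} .{{_ : NonZero t}} → 1 ≤ t → IsPartition xs → length xs ≤ m →
                         Star (RemoveStrip t) xs κ →
                         IsPartition κ × length κ ≤ m × (∀ i → nCount t i xs m ≡ nCount t i κ m)
removeStrips-invariant t≥1 xs-part len≤m ε = xs-part , len≤m , λ _ → refl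
removeStrips-invariant {xs = xs} t≥1 xs-part len≤m (strip ◅ strips)
  with removeStrips-invariant t≥1 (proj₁ strip)
         (length-contained xs (proj₂ (proj₁ strip)) (proj₁ (proj₂ strip)) len≤m) strips
... | κ-part , lenκ≤m , same = κ-part , lenκ≤m , λ i → trans (nCount-removeStrip t≥1 xs-part len≤m strip i) (same i)

∸-suc-shift : ∀ m r d → r + d < m → m ∸ suc r ≡ d + (m ∸ suc (r + d))
∸-suc-shift m r d r+d<m with m≤n⇒∃[o]m+o≡n r+d<m
... | w , refl = trans (cong (_∸ suc r) (+-assoc (suc r) d w))
                       (trans (m+n∸m≡n (suc r) (d + w)) (cong (d +_) (sym (m+n∸m≡n (suc (r + d)) w))))

adjacent-sym : ∀ a b → Adjacent a b → Adjacent b a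
adjacent-sym _ _ (inj₁ (i≡ , inj₁ j+1≡)) = inj₁ (sym i≡ , inj₂ (sym j+1≡))
adjacent-sym _ _ (inj₁ (i≡ , inj₂ j≡))   = inj₁ (sym i≡ , inj₁ (sym j≡))
adjacent-sym _ _ (inj₂ (j≡ , inj₁ i+1≡)) = inj₂ (sym j≡ , inj₂ (sym i+1≡))
adjacent-sym _ _ (inj₂ (j≡ , inj₂ i≡))   = inj₂ (sym j≡ , inj₁ (sym i≡))

connected-via-hub : ∀ {S : Cell → Set} hub → (∀ c → S c → Star (λ x y → S x × S y × Adjacent x y) c hub) → Connected S
connected-via-hub hub to-hub a b a∈ b∈ =
  to-hub a a∈ ◅◅ reverse (λ { (x∈ , y∈ , adj) → y∈ , x∈ , adjacent-sym _ _ adj }) (to-hub b b∈)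

skew-row-path : ∀ xs ys p {a} b → part ys p ≤ a → a ≤ b → b < part xs p → Star (SkewStep xs ys) (p , b) (p , a)
skew-row-path xs ys p zero    _    z≤n     _     = ε
skew-row-path xs ys p {a} (suc b) ys≤a a≤b+1 b+1<xs with m≤n⇒m<n∨m≡n a≤b+1
... | inj₂ refl      = ε
... | inj₁ (s≤s a≤b) = (cell (m≤n⇒m≤1+n a≤b) b+1<xs , cell a≤b b<xs , inj₁ (refl , inj₂ refl))
                       ◅ skew-row-path xs ys p b ys≤a a≤b b<xs
  where
  b<xs : b < part xs p
  b<xs = <-trans (n<1+n b) b+1<xs
  cell : ∀ {c} → a ≤ c → c < part xs p → InSkew xs ys (p , c)
  cell a≤c c<xs = c<xs , ≤⇒≯ (≤-trans ys≤a a≤c)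

row-bound⇒no2x2 : ∀ {xs ys} → (∀ p → part xs (suc p) ≤ suc (part ys p)) → No2x2 (InSkew xs ys)
row-bound⇒no2x2 bound p q ((_ , q≮ys) , _ , _ , (q+1<xs₊ , _)) =
  q≮ys (≤-pred (≤-trans q+1<xs₊ (bound p)))

-- The border strip of size t that runs from the end of row r down to column j of row r + k.
module StripConstruction {xs : Partition} (xs↓ : Linked _≥_ xs) {t r k j : ℕ}
  (j<xsₛ : j < part xs (r + k)) (xsₛ₊≤j : part xs (suc (r + k)) ≤ j) (drop : part xs r + k ≡ j + t) where

  private
    F : ℕ → ℕ
    F = part xs
    s L : ℕ
    s = r + k
    L = length xs

  data Region (p : ℕ) : Set where
    above  : p < r → Region p
    inside : r ≤ p → p < s → Region p
    last   : p ≡ s → Region p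
    below  : s < p → Region p

  region : ∀ p → Region p
  region p with p <? r | p <? s | p ≟ s
  ... | yes p<r | _       | _       = above p<r
  ... | no  p≮r | yes p<s | _       = inside (≮⇒≥ p≮r) p<s
  ... | no  _   | no  _   | yes p≡s = last p≡s
  ... | no  _   | no  p≮s | no  p≢s = below (≤∧≢⇒< (≮⇒≥ p≮s) (p≢s ∘ sym))

  rowIn : ∀ p → Region p → ℕ
  rowIn p (above _)    = F p
  rowIn p (inside _ _) = pred (F (suc p))
  rowIn p (last _)     = j
  rowIn p (below _)    = F p

  row : ℕ → ℕ
  row p = rowIn p (region p)

  r≤s : r ≤ s
  r≤s = m≤m+n r k

  row-outside : ∀ p → p < r ⊎ s < p → row p ≡ F p
  row-outside p p∉ with region p | p∉
  ... | above _      | _          = refl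
  ... | below _      | _          = refl
  ... | inside r≤p _ | inj₁ p<r   = ⊥-elim (<⇒≱ p<r r≤p)
  ... | inside _ p<s | inj₂ s<p   = ⊥-elim (<-asym p<s s<p)
  ... | last refl    | inj₁ s<r   = ⊥-elim (<⇒≱ s<r r≤s)
  ... | last refl    | inj₂ s<p   = ⊥-elim (<-irrefl refl s<p)

  row-inside : ∀ p → r ≤ p → p < s → row p ≡ pred (F (suc p))
  row-inside p r≤p p<s with region p
  ... | inside _ _ = refl
  ... | above p<r  = ⊥-elim (<⇒≱ p<r r≤p)
  ... | last refl  = ⊥-elim (<-irrefl refl p<s)
  ... | below s<p  = ⊥-elim (<-asym p<s s<p)

  row-last : row s ≡ j
  row-last with region s
  ... | last _        = refl
  ... | above s<r     = ⊥-elim (<⇒≱ s<r r≤s)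
  ... | inside _ s<s′ = ⊥-elim (<-irrefl refl s<s′)
  ... | below s<s′    = ⊥-elim (<-irrefl refl s<s′)

  s<L : s < L
  s<L = ≰⇒> λ L≤s → n≮0 (subst (j <_) (part-≥length xs L≤s) j<xsₛ)

  xs₊-positive : ∀ p → p < s → 0 < F (suc p)
  xs₊-positive p p<s = <-≤-trans (≤-<-trans z≤n j<xsₛ) (part-antitone xs↓ p<s)

  row≤xs : ∀ p → row p ≤ F p
  row≤xs p with region p
  ... | above _    = ≤-refl
  ... | inside _ _ = ≤-trans pred[n]≤n (part-suc≤ xs↓ p)
  ... | last refl  = <⇒≤ j<xsₛ
  ... | below _    = ≤-refl

  row-suc≤ : ∀ p → row (suc p) ≤ row p
  row-suc≤ p with region p
  ... | above _   = ≤-trans (row≤xs (suc p)) (part-suc≤ xs↓ p)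
  ... | below _   = ≤-trans (row≤xs (suc p)) (part-suc≤ xs↓ p)
  ... | last refl = ≤-trans (≤-reflexive (row-outside (suc s) (inj₂ (n<1+n s)))) xsₛ₊≤j
  ... | inside r≤p p<s with m≤n⇒m<n∨m≡n p<s
  ...   | inj₁ p+1<s = ≤-trans (≤-reflexive (row-inside (suc p) (m≤n⇒m≤1+n r≤p) p+1<s))
                               (pred-mono-≤ (part-suc≤ xs↓ (suc p)))
  ...   | inj₂ p+1≡s = subst (λ q → row q ≤ pred (F q)) (sym p+1≡s) (≤-trans (≤-reflexive row-last) (<⇒≤pred j<xsₛ))

  row-bound : ∀ p → F (suc p) ≤ suc (row p)
  row-bound p with region p
  ... | above _    = ≤-trans (part-suc≤ xs↓ p) (n≤1+n _)
  ... | below _    = ≤-trans (part-suc≤ xs↓ p) (n≤1+n _)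
  ... | last refl  = ≤-trans xsₛ₊≤j (n≤1+n j)
  ... | inside _ p<s = ≤-reflexive (sym (suc-pred (F (suc p)) {{>-nonZero (xs₊-positive p p<s)}}))

  smaller : Partition
  smaller = fromParts row L

  part-smaller : ∀ p → part smaller p ≡ row p
  part-smaller = part-fromParts row L row-suc≤
                   λ p L≤p → n≤0⇒n≡0 (≤-trans (row≤xs p) (≤-reflexive (part-≥length xs L≤p)))

  smaller-isPartition : IsPartition smaller
  smaller-isPartition = linked-from-part smaller
                          (λ p → subst₂ _≤_ (sym (part-smaller (suc p))) (sym (part-smaller p)) (row-suc≤ p))
                      , fromParts-positive row L

  length-smaller : length smaller ≤ L
  length-smaller = length≤ (proj₂ smaller-isPartition)
                     (trans (part-smaller L) (n≤0⇒n≡0 (≤-trans (row≤xs L) (≤-reflexive (part-≥length xs ≤-refl)))))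

  move : MovesOneBead L xs smaller r s
  move = record
    { r≤s       = r≤s
    ; s<m       = s<L
    ; unchanged = λ p p∉ → trans (part-smaller p) (row-outside p p∉)
    ; shifted   = λ p r≤p p<s → trans (cong suc (trans (part-smaller p) (row-inside p r≤p p<s)))
                                      (suc-pred (F (suc p)) {{>-nonZero (xs₊-positive p p<s)}})
    }

  bead-drop : β xs L r ≡ β smaller L s + t
  bead-drop = begin
    F r + (L ∸ suc r)            ≡⟨ cong (F r +_) (∸-suc-shift L r k s<L) ⟩
    F r + (k + A)                ≡⟨ sym (+-assoc (F r) k A) ⟩
    F r + k + A                  ≡⟨ cong (_+ A) drop ⟩
    j + t + A                    ≡⟨ solve 3 (λ j t A → j :+ t :+ A := j :+ A :+ t) refl j t A ⟩
    j + A + t                    ≡⟨ cong (λ v → v + A + t) (sym (trans (part-smaller s) row-last)) ⟩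
    part smaller s + A + t       ∎
    where
    open ≡-Reasoning
    A : ℕ
    A = L ∸ suc s

  skew-rows : ∀ {p q} → InSkew xs smaller (p , q) → r ≤ p × p ≤ s
  skew-rows {p} {q} (q<xs , q≮sm) = ≮⇒≥ (λ p<r → outside (inj₁ p<r)) , ≮⇒≥ (λ s<p → outside (inj₂ s<p))
    where
    outside : p < r ⊎ s < p → ⊥
    outside p∉ = q≮sm (subst (q <_) (sym (MovesOneBead.unchanged move p p∉)) q<xs)

  to-corner : ∀ d {p q} → p + d ≡ s → InSkew xs smaller (p , q) → Star (SkewStep xs smaller) (p , q) (s , j)
  to-corner zero {p} {q} p+0≡s (q<xs , q≮sm) rewrite trans (sym (+-identityʳ p)) p+0≡s =
    skew-row-path xs smaller s q (≤-reflexive sₛ≡j) (≮⇒≥ (q≮sm ∘ subst (q <_) (sym sₛ≡j))) q<xs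
    where
    sₛ≡j : part smaller s ≡ j
    sₛ≡j = trans (part-smaller s) row-last
  to-corner (suc d) {p} {q} p+d+1≡s cell@(q<xs , q≮sm) =
    skew-row-path xs smaller p q ≤-refl Gp≤q q<xs ◅◅ (down ◅ to-corner d (trans (sym (+-suc p d)) p+d+1≡s) cell₊)
    where
    G : ℕ → ℕ
    G = part smaller
    Gp≤q : G p ≤ q
    Gp≤q = ≮⇒≥ q≮sm
    cell₊ : InSkew xs smaller (suc p , G p)
    cell₊ = ≤-reflexive (MovesOneBead.shifted move p (proj₁ (skew-rows cell)) (subst (p <_) p+d+1≡s (m<m+n p z<s)))
          , ≤⇒≯ (part-suc≤ (proj₁ smaller-isPartition) p)
    down : SkewStep xs smaller (p , G p) (suc p , G p)
    down = (≤-<-trans Gp≤q q<xs , <-irrefl refl) , cell₊ , inj₂ (refl , inj₁ refl)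

  removable : RemoveStrip t xs smaller
  removable = smaller-isPartition
            , (λ p → subst (_≤ F p) (sym (part-smaller p)) (row≤xs p))
            , from (size-drop⇔bead-drop move ≤-refl length-smaller t) bead-drop
            , connected-via-hub (s , j) (λ { (p , q) cell → to-corner (s ∸ p) (m+[n∸m]≡n (proj₂ (skew-rows cell))) cell })
            , row-bound⇒no2x2 {xs} {smaller} (λ p → subst (F (suc p) ≤_) (cong suc (sym (part-smaller p))) (row-bound p))

-- The abacus

module Abacus {xs : Partition} (xs↓ : Linked _≥_ xs) {m : ℕ} (len≤m : length xs ≤ m) where

  bead : ℕ → ℕ
  bead = β xs m

  bead-≥m : ∀ p → m ≤ p → bead p ≡ 0
  bead-≥m p m≤p = cong₂ _+_ (part-≥length xs (≤-trans len≤m m≤p)) (m≤n⇒m∸n≡0 (m≤n⇒m≤1+n m≤p))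

  bead-suc≤ : ∀ p → bead (suc p) ≤ bead p
  bead-suc≤ p = +-mono-≤ (part-suc≤ xs↓ p) (∸-monoʳ-≤ m (n≤1+n (suc p)))

  bead-suc< : ∀ p → suc p < m → bead (suc p) < bead p
  bead-suc< p p+1<m = begin-strict
    part xs (suc p) + (m ∸ suc (suc p))    <⟨ +-monoʳ-< (part xs (suc p)) (n<1+n _) ⟩
    part xs (suc p) + suc (m ∸ suc (suc p)) ≤⟨ +-monoˡ-≤ _ (part-suc≤ xs↓ p) ⟩
    part xs p + suc (m ∸ suc (suc p))       ≡⟨ cong (part xs p +_) (sym (∸-suc m (suc p) p+1<m)) ⟩
    part xs p + (m ∸ suc p)                 ∎
    where open ≤-Reasoning

  bead-antitone : ∀ {p q} → p ≤ q → bead q ≤ bead p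
  bead-antitone = stepwise-antitone bead-suc≤

  bead-strict : ∀ {p q} → p < q → q < m → bead q < bead p
  bead-strict {p} {suc q} (s≤s p≤q) q+1<m = <-≤-trans (bead-suc< q q+1<m) (bead-antitone p≤q)

  beadsAbove : ℕ → ℕ
  beadsAbove X = ∑[ p < m ] 𝟙 (X <? bead p)

  <beadsAbove⇔ : ∀ X p → p < beadsAbove X ⇔ X < bead p
  <beadsAbove⇔ X = <∑𝟙⇔ m (λ p → X <? bead p) (λ p X<bead₊ → <-≤-trans X<bead₊ (bead-suc≤ p))
                     (λ p m≤p X<bead → n≮0 (subst (X <_) (bead-≥m p m≤p) X<bead))

  beadsAbove≤m : ∀ X → beadsAbove X ≤ m
  beadsAbove≤m X = ≤-trans (∑-mono-≤ m (λ p _ → 𝟙≤1 (X <? bead p))) (≤-reflexive (∑-one m))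

  beadAt : ℕ → ℕ
  beadAt x = ∑[ p < m ] 𝟙 (bead p ≟ x)

  beadsAbove-suc : ∀ X → beadsAbove X ≡ beadAt (suc X) + beadsAbove (suc X)
  beadsAbove-suc X = trans (∑-cong m (λ p _ → 𝟙-<-suc X (bead p))) (∑-distrib-+ m _ _)

  m≡beadAt0+beadsAbove0 : m ≡ beadAt 0 + beadsAbove 0
  m≡beadAt0+beadsAbove0 = trans (sym (∑-one m)) (trans (∑-cong m (λ p _ → 𝟙-≟0 (bead p))) (∑-distrib-+ m _ _))

  beadAt≤1 : ∀ x → beadAt x ≤ 1
  beadAt≤1 x = ∑𝟙≟-≤1 m bead x bead-strict

  beadAt-bead : ∀ {p} → p < m → 0 < beadAt (bead p)
  beadAt-bead {p} p<m = <-≤-trans (subst (0 <_) (sym (𝟙-yes (bead p ≟ bead p) refl)) z<s)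
                                  (term≤∑ m (λ q → 𝟙 (bead q ≟ bead p)) p<m)

  beadAt⇒bead : ∀ {x} → 0 < beadAt x → ∃[ p ] p < m × bead p ≡ x
  beadAt⇒bead {x} 0<beadAt
    with ∑-<⇒ m (λ _ → 0) (λ p → 𝟙 (bead p ≟ x)) (subst (_< beadAt x) (sym (∑-zero m (λ _ _ → refl))) 0<beadAt)
  ... | p , p<m , 0<𝟙 = p , p<m , 𝟙-pos⇒ (bead p ≟ x) 0<𝟙

  beadAt-beyond : ∀ {x} → bead 0 < x → beadAt x ≡ 0
  beadAt-beyond {x} bead0<x = ∑-zero m λ p _ →
    𝟙-no (bead p ≟ x) (λ bead≡x → <⇒≱ bead0<x (subst (_≤ bead 0) bead≡x (bead-antitone z≤n)))

  between-beads : ∀ {s x} → x < bead s → (suc s < m → bead (suc s) < x) →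
                  ∃[ j ] j < part xs s × part xs (suc s) ≤ j × j + (m ∸ suc s) ≡ x
  between-beads {s} {x} x<beadₛ beadₛ₊<x with suc s <? m
  ... | no s+1≮m = x , subst (x <_) (trans (cong (part xs s +_) A≡0) (+-identityʳ _)) x<beadₛ
                     , ≤-trans (≤-reflexive (part-≥length xs (≤-trans len≤m (≮⇒≥ s+1≮m)))) z≤n
                     , trans (cong (x +_) A≡0) (+-identityʳ x)
    where
    A≡0 : m ∸ suc s ≡ 0
    A≡0 = m≤n⇒m∸n≡0 (≮⇒≥ s+1≮m)
  ... | yes s+1<m = x ∸ A , +-cancelʳ-< A (x ∸ A) (part xs s) (subst (_< bead s) (sym j+A≡x) x<beadₛ)
                          , +-cancelʳ-≤ A _ _ (subst (part xs (suc s) + A ≤_) (sym j+A≡x) xsₛ₊+A≤x)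
                          , j+A≡x
    where
    A : ℕ
    A = m ∸ suc s
    xsₛ₊+A≤x : part xs (suc s) + A ≤ x
    xsₛ₊+A≤x = subst (λ a → part xs (suc s) + a ≤ x) (sym (∸-suc m (suc s) s+1<m))
                 (subst (_≤ x) (sym (+-suc (part xs (suc s)) _)) (beadₛ₊<x s+1<m))
    j+A≡x : x ∸ A + A ≡ x
    j+A≡x = m∸n+n≡m (≤-trans (m≤n+m A _) xsₛ₊+A≤x)

module _ {t xs} (t≥1 : 1 ≤ t) (xs↓ : Linked _≥_ xs) {m} (len≤m : length xs ≤ m) where
  open Abacus xs↓ len≤m

  slide-bead : ∀ {x p} → bead p ≡ x + t → ¬ 0 < beadAt x → ∃[ ν ] RemoveStrip t xs ν
  slide-bead {x} {p} beadₚ≡ empty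
    with beadsAbove x in above≡ | from (<beadsAbove⇔ x p) (subst (x <_) (sym beadₚ≡) (m<m+n x t≥1))
  ... | suc e | s≤s p≤e with m≤n⇒∃[o]m+o≡n p≤e
  ...   | k , refl with between-beads x<beadₑ beadₑ₊<x
    where
    x<beadₑ : x < bead (p + k)
    x<beadₑ = to (<beadsAbove⇔ x (p + k)) (subst (p + k <_) (sym above≡) ≤-refl)
    beadₑ₊<x : suc (p + k) < m → bead (suc (p + k)) < x
    beadₑ₊<x e+1<m = ≤∧≢⇒<
      (≮⇒≥ (λ x<beadₑ₊ → <-irrefl (sym above≡) (from (<beadsAbove⇔ x (suc (p + k))) x<beadₑ₊)))
                           (λ beadₑ₊≡x → empty (subst (λ v → 0 < beadAt v) beadₑ₊≡x (beadAt-bead e+1<m)))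
  ...     | j , j<xsₑ , xsₑ₊≤j , j+A≡x = _ , StripConstruction.removable xs↓ j<xsₑ xsₑ₊≤j drop
    where
    A : ℕ
    A = m ∸ suc (p + k)
    e<m : p + k < m
    e<m = subst (_≤ m) above≡ (beadsAbove≤m x)
    drop : part xs p + k ≡ j + t
    drop = +-cancelʳ-≡ A _ _ (begin
      part xs p + k + A          ≡⟨ +-assoc (part xs p) k A ⟩
      part xs p + (k + A)        ≡⟨ cong (part xs p +_) (sym (∸-suc-shift m p k e<m)) ⟩
      bead p                     ≡⟨ beadₚ≡ ⟩
      x + t                      ≡⟨ cong (_+ t) (sym j+A≡x) ⟩
      j + A + t                  ≡⟨ solve 3 (λ j A t → j :+ A :+ t := j :+ t :+ A) refl j A t ⟩
      j + t + A                  ∎)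
      where open ≡-Reasoning

  core⇒flush : (∀ ν → ¬ RemoveStrip t xs ν) → ∀ x → 0 < beadAt (x + t) → 0 < beadAt x
  core⇒flush core x occupied with beadAt⇒bead occupied | 0 <? beadAt x
  ... | _              | yes 0<beadAt = 0<beadAt
  ... | p , _ , beadₚ≡ | no  empty    = ⊥-elim (core _ (proj₂ (slide-bead beadₚ≡ empty)))

-- Self-conjugacy on the abacus

Symmetric : Partition → Set
Symmetric xs = ∀ p q → q < part xs p → p < part xs q

<part-conjugate⇔ : ∀ {xs} → Linked _≥_ xs → ∀ q p → p < part (conjugate xs) q ⇔ q < part xs p
<part-conjugate⇔ {xs} xs↓ q p = subst (λ c → p < c ⇔ q < part xs p) (sym (part-conjugate xs↓ q))
  (<∑𝟙⇔ (length xs) (λ p → q <? part xs p) (λ p q<xs₊ → <-≤-trans q<xs₊ (part-suc≤ xs↓ p))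
        (λ p len≤p q<xs → n≮0 (subst (q <_) (part-≥length xs len≤p) q<xs)) p)

selfConjugate⇔symmetric : ∀ {xs} → IsPartition xs → SelfConjugate xs ⇔ Symmetric xs
selfConjugate⇔symmetric {xs} (xs↓ , xs>0) = mk⇔
  (λ sc p q q<xsₚ → subst (λ ys → p < part ys q) sc (from (<part-conjugate⇔ xs↓ q p) q<xsₚ))
  (λ cells-sym → part-injective (conjugate-positive xs) xs>0 λ q → ≡-from-<⇔ _ _ λ p →
     mk⇔ (cells-sym p q ∘ to (<part-conjugate⇔ xs↓ q p)) (from (<part-conjugate⇔ xs↓ q p) ∘ cells-sym q p))

∸-+-shift : ∀ M D r → D + r ≤ M → r + (M ∸ (D + r)) ≡ M ∸ D
∸-+-shift M D r D+r≤M with m≤n⇒∃[o]m+o≡n D+r≤M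
... | w , refl = trans (cong (r +_) (m+n∸m≡n (D + r) w))
                       (sym (trans (cong (_∸ D) (+-assoc D r w)) (m+n∸m≡n D (r + w))))

+-∸-shift : ∀ M D r → r ≤ M → D + r + (M ∸ r) ≡ M + D
+-∸-shift M D r r≤M with m≤n⇒∃[o]m+o≡n r≤M
... | w , refl = trans (cong (D + r +_) (m+n∸m≡n r w)) (solve 3 (λ D r w → D :+ r :+ w := r :+ w :+ D) refl D r w)

≤⇒∃[o]o+m≡n : ∀ {m n} → m ≤ n → ∃[ o ] o + m ≡ n
≤⇒∃[o]o+m≡n m≤n = _ , m∸n+n≡m m≤n

≡-+-from-< : ∀ a D c → (∀ p → p < D → p < a) → (∀ r → D + r < a ⇔ r < c) → a ≡ D + c
≡-+-from-< a D c low high = ≡-from-<⇔ a (D + c) below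
  where
  below : ∀ p → p < a ⇔ p < D + c
  below p with p <? D
  ... | yes p<D = mk⇔ (λ _ → <-≤-trans p<D (m≤m+n D c)) (λ _ → low p p<D)
  ... | no  p≮D with m≤n⇒∃[o]m+o≡n (≮⇒≥ p≮D)
  ...   | r , refl = mk⇔ (+-monoʳ-< D ∘ to (high r)) (from (high r) ∘ +-cancelˡ-< D r c)

module AbacusSymmetry {xs : Partition} (xs↓ : Linked _≥_ xs) (M : ℕ) (len≤m : length xs ≤ suc M) where
  open Abacus xs↓ len≤m

  private
    m : ℕ
    m = suc M

  -- beadsAbove (M + D) counts the cells of content D (column minus row) and beadsAbove (M ∸ D) is D plus
  -- the number of cells of content -D, so Balanced says that these two diagonals have the same length.
  Balanced : Set
  Balanced = ∀ D → D ≤ M → beadsAbove (M ∸ D) ≡ D + beadsAbove (M + D)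

  Bounded : Set
  Bounded = ∀ X → m + M ≤ X → beadsAbove X ≡ 0

  -- The set of bead positions is its own complement reflected in the window [0, 2m).
  ComplementSymmetric : Set
  ComplementSymmetric = (∀ x y → x + y ≡ M + m → beadAt x + beadAt y ≡ 1) × (∀ x → m + m ≤ x → beadAt x ≡ 0)

  cell⇔ : ∀ p q {X} → q + (M ∸ p) ≡ X → q < part xs p ⇔ p < beadsAbove X
  cell⇔ p q refl = mk⇔ (from (<beadsAbove⇔ _ p) ∘ +-monoˡ-< (M ∸ p)) (+-cancelʳ-< (M ∸ p) q _ ∘ to (<beadsAbove⇔ _ p))

  row<m : ∀ {p q} → q < part xs p → p < m
  row<m {p} {q} q<xsₚ = ≰⇒> λ m≤p → n≮0 (subst (q <_) (part-≥length xs (≤-trans len≤m m≤p)) q<xsₚ)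

  symmetric⇒bounded : Symmetric xs → Bounded
  symmetric⇒bounded cells-sym X m+M≤X = n≤0⇒n≡0 (≮⇒≥ λ 0<above →
    n≮0 (subst (0 <_) (part-≥length xs (≤-trans len≤m ≤-refl))
          (cells-sym 0 m (+-cancelʳ-< M m (part xs 0) (≤-<-trans m+M≤X (to (<beadsAbove⇔ X 0) 0<above))))))

  symmetric⇒balanced : Symmetric xs → Balanced
  symmetric⇒balanced cells-sym D D≤M = ≡-+-from-< _ D _ low high
    where
    low : ∀ p → p < D → p < beadsAbove (M ∸ D)
    low p p<D = from (<beadsAbove⇔ _ p) (<-≤-trans (∸-monoʳ-< p<D D≤M) (m≤n+m (M ∸ p) (part xs p)))
    high : ∀ r → D + r < beadsAbove (M ∸ D) ⇔ r < beadsAbove (M + D)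
    high r with D + r ≤? M
    ... | yes D+r≤M = mk⇔
      (to (cell⇔ r (D + r) (+-∸-shift M D r r≤M)) ∘ cells-sym (D + r) r ∘ from (cell⇔ (D + r) r (∸-+-shift M D r D+r≤M)))
      (to (cell⇔ (D + r) r (∸-+-shift M D r D+r≤M)) ∘ cells-sym r (D + r) ∘ from (cell⇔ r (D + r) (+-∸-shift M D r r≤M)))
      where
      r≤M : r ≤ M
      r≤M = ≤-trans (m≤n+m r D) D+r≤M
    ... | no  D+r≰M = mk⇔ (λ D+r<above → ⊥-elim (<⇒≱ D+r<above (≤-trans (beadsAbove≤m _) (≰⇒> D+r≰M))))
                          (⊥-elim ∘ r-out-of-range)
      where
      r-out-of-range : r < beadsAbove (M + D) → ⊥
      r-out-of-range r<above with r ≤? M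
      ... | yes r≤M = D+r≰M (≤-pred (row<m (cells-sym r (D + r) (from (cell⇔ r (D + r) (+-∸-shift M D r r≤M)) r<above))))
      ... | no  r≰M = n≮0 (subst (M + D <_) (bead-≥m r (≰⇒> r≰M)) (to (<beadsAbove⇔ _ r) r<above))

  balanced⇒symmetric : Balanced → Bounded → Symmetric xs
  balanced⇒symmetric balanced bounded p q q<xsₚ with ≤-total q p
  ... | inj₁ q≤p with ≤⇒∃[o]o+m≡n q≤p
  ...   | D , refl = from (cell⇔ q (D + q) (+-∸-shift M D q (≤-trans (m≤n+m q D) D+q≤M)))
                       (+-cancelˡ-< D q _ (subst (D + q <_) (balanced D (≤-trans (m≤m+n D q) D+q≤M))
                         (to (cell⇔ (D + q) q (∸-+-shift M D q D+q≤M)) q<xsₚ)))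
    where
    D+q≤M : D + q ≤ M
    D+q≤M = ≤-pred (row<m q<xsₚ)
  balanced⇒symmetric balanced bounded p q q<xsₚ | inj₂ p≤q with ≤⇒∃[o]o+m≡n p≤q
  ...   | D , refl = from (cell⇔ (D + p) p (∸-+-shift M D p D+p≤M))
                       (subst (D + p <_) (sym (balanced D (≤-trans (m≤m+n D p) D+p≤M)))
                         (+-monoʳ-< D (to (cell⇔ p (D + p) (+-∸-shift M D p (≤-trans (m≤n+m p D) D+p≤M))) q<xsₚ)))
    where
    D+p≤M : D + p ≤ M
    D+p≤M = ≮⇒≥ λ M<D+p → n≮0 (subst (0 <_) (bounded (D + p + M) (+-monoˡ-≤ M M<D+p))
              (to (cell⇔ 0 (D + p) refl) (<-≤-trans q<xsₚ (part-antitone xs↓ z≤n))))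

  complement-sum : ∀ D → D ≤ M → M ∸ D + suc (M + D) ≡ M + m
  complement-sum D D≤M = begin
    M ∸ D + suc (M + D)    ≡⟨ +-suc (M ∸ D) (M + D) ⟩
    suc (M ∸ D + (M + D))  ≡⟨ cong (λ v → suc (M ∸ D + v)) (+-comm M D) ⟩
    suc (M ∸ D + (D + M))  ≡⟨ cong suc (sym (+-assoc (M ∸ D) D M)) ⟩
    suc (M ∸ D + D + M)    ≡⟨ cong (λ v → suc (v + M)) (m∸n+n≡m D≤M) ⟩
    suc (M + M)            ≡⟨ sym (+-suc M M) ⟩
    M + m                  ∎
    where open ≡-Reasoning

  complementSymmetric⇒bounded : ComplementSymmetric → Bounded
  complementSymmetric⇒bounded (_ , empty) X m+M≤X = n≤0⇒n≡0 (≮⇒≥ λ 0<above →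
    <-irrefl (sym (empty (bead 0) (subst (_≤ bead 0) (sym (+-suc m M)) (≤-<-trans m+M≤X (to (<beadsAbove⇔ X 0) 0<above)))))
             (beadAt-bead z<s))

  complementSymmetric⇒balanced : ComplementSymmetric → Balanced
  complementSymmetric⇒balanced cs zero    _     = cong beadsAbove (sym (+-identityʳ M))
  complementSymmetric⇒balanced cs (suc D) D<M = begin
    beadsAbove (M ∸ suc D)                                    ≡⟨ beadsAbove-suc (M ∸ suc D) ⟩
    beadAt (suc (M ∸ suc D)) + beadsAbove (suc (M ∸ suc D))   ≡⟨ cong (λ v → beadAt v + beadsAbove v) (sym (∸-suc M D D<M)) ⟩
    beadAt x + beadsAbove x                                   ≡⟨ cong (beadAt x +_) (complementSymmetric⇒balanced cs D (<⇒≤ D<M)) ⟩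
    beadAt x + (D + beadsAbove (M + D))                       ≡⟨ cong (λ v → beadAt x + (D + v)) (beadsAbove-suc (M + D)) ⟩
    beadAt x + (D + (beadAt y + beadsAbove y))                ≡⟨ solve 4 (λ a D b n → a :+ (D :+ (b :+ n)) := (a :+ b) :+ (D :+ n))
                                                                   refl (beadAt x) D (beadAt y) (beadsAbove y) ⟩
    (beadAt x + beadAt y) + (D + beadsAbove y)                ≡⟨ cong (_+ (D + beadsAbove y)) (proj₁ cs x y (complement-sum D (<⇒≤ D<M))) ⟩
    suc D + beadsAbove y                                      ≡⟨ cong (λ v → suc D + beadsAbove v) (sym (+-suc M D)) ⟩
    suc D + beadsAbove (M + suc D)                            ∎
    where
    open ≡-Reasoning
    x y : ℕ
    x = M ∸ D
    y = suc (M + D)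

  beads-from-M∸D : Balanced → Bounded → ∀ D → D ≤ M →
                   beadAt (M ∸ D) + beadsAbove (M ∸ D) ≡ suc D + beadsAbove (suc (M + D))
  beads-from-M∸D balanced bounded D D≤M with m≤n⇒m<n∨m≡n D≤M
  ... | inj₁ D<M = begin
    beadAt (M ∸ D) + beadsAbove (M ∸ D)                      ≡⟨ cong (λ v → beadAt v + beadsAbove v) (∸-suc M D D<M) ⟩
    beadAt (suc (M ∸ suc D)) + beadsAbove (suc (M ∸ suc D))  ≡⟨ sym (beadsAbove-suc (M ∸ suc D)) ⟩
    beadsAbove (M ∸ suc D)                                   ≡⟨ balanced (suc D) D<M ⟩
    suc D + beadsAbove (M + suc D)                           ≡⟨ cong (λ v → suc D + beadsAbove v) (+-suc M D) ⟩
    suc D + beadsAbove (suc (M + D))                         ∎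
    where open ≡-Reasoning
  ... | inj₂ refl = begin
    beadAt (M ∸ M) + beadsAbove (M ∸ M)  ≡⟨ cong (λ v → beadAt v + beadsAbove v) (n∸n≡0 M) ⟩
    beadAt 0 + beadsAbove 0              ≡⟨ sym m≡beadAt0+beadsAbove0 ⟩
    m                                    ≡⟨ sym (+-identityʳ m) ⟩
    m + 0                                ≡⟨ cong (m +_) (sym (bounded (suc (M + M)) ≤-refl)) ⟩
    suc M + beadsAbove (suc (M + M))     ∎
    where open ≡-Reasoning

  balanced⇒complementSymmetric : Balanced → Bounded → ComplementSymmetric
  balanced⇒complementSymmetric balanced bounded = pairs , empty
    where
    pair : ∀ D → D ≤ M → beadAt (M ∸ D) + beadAt (suc (M + D)) ≡ 1
    pair D D≤M = +-cancelʳ-≡ (D + N) _ 1 (begin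
      beadAt (M ∸ D) + beadAt y + (D + N)    ≡⟨ solve 4 (λ a b D n → a :+ b :+ (D :+ n) := a :+ (D :+ (b :+ n)))
                                                   refl (beadAt (M ∸ D)) (beadAt y) D N ⟩
      beadAt (M ∸ D) + (D + (beadAt y + N))  ≡⟨ cong (λ v → beadAt (M ∸ D) + (D + v)) (sym (beadsAbove-suc (M + D))) ⟩
      beadAt (M ∸ D) + (D + beadsAbove (M + D)) ≡⟨ cong (beadAt (M ∸ D) +_) (sym (balanced D D≤M)) ⟩
      beadAt (M ∸ D) + beadsAbove (M ∸ D)    ≡⟨ beads-from-M∸D balanced bounded D D≤M ⟩
      1 + (D + N)                            ∎)
      where
      open ≡-Reasoning
      y N : ℕ
      y = suc (M + D)
      N = beadsAbove y
    pair≤M : ∀ x y → x ≤ M → x + y ≡ M + m → beadAt x + beadAt y ≡ 1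
    pair≤M x y x≤M x+y≡ = subst₂ (λ u v → beadAt u + beadAt v ≡ 1) x≡ y≡ (pair (M ∸ x) (m∸n≤m M x))
      where
      x≡ : M ∸ (M ∸ x) ≡ x
      x≡ = m∸[m∸n]≡n x≤M
      y≡ : suc (M + (M ∸ x)) ≡ y
      y≡ = +-cancelˡ-≡ x _ y (trans (subst (λ u → u + suc (M + (M ∸ x)) ≡ M + m) x≡
                                           (complement-sum (M ∸ x) (m∸n≤m M x)))
                                    (sym x+y≡))
    pairs : ∀ x y → x + y ≡ M + m → beadAt x + beadAt y ≡ 1
    pairs x y x+y≡ with x ≤? M
    ... | yes x≤M = pair≤M x y x≤M x+y≡
    ... | no  x≰M = trans (+-comm (beadAt x) (beadAt y)) (pair≤M y x y≤M (trans (+-comm y x) x+y≡))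
      where
      y≤M : y ≤ M
      y≤M = ≮⇒≥ λ M<y → <-irrefl (sym x+y≡) (+-mono-≤ (≰⇒> x≰M) M<y)
    empty : ∀ x → m + m ≤ x → beadAt x ≡ 0
    empty (suc x) m+m≤x+1 = m+n≡0⇒m≡0 (beadAt (suc x)) (trans (sym (beadsAbove-suc x))
                              (bounded x (≤-pred (subst (_≤ suc x) (+-suc m M) m+m≤x+1))))

  selfConjugate⇔complementSymmetric : All (0 <_) xs → SelfConjugate xs ⇔ ComplementSymmetric
  selfConjugate⇔complementSymmetric xs>0 = mk⇔
    (λ sc → let cells = to symmetric sc in balanced⇒complementSymmetric (symmetric⇒balanced cells) (symmetric⇒bounded cells))
    (λ cs → from symmetric (balanced⇒symmetric (complementSymmetric⇒balanced cs) (complementSymmetric⇒bounded cs)))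
    where
    symmetric : SelfConjugate xs ⇔ Symmetric xs
    symmetric = selfConjugate⇔symmetric (xs↓ , xs>0)

-- Runners of a t-core

𝟙<-complement : ∀ {k k′ a a′ Q} → k + k′ + 1 ≡ Q → a + a′ ≡ Q → 𝟙 (k <? a) + 𝟙 (k′ <? a′) ≡ 1
𝟙<-complement {k} {k′} {a} {a′} {Q} k+k′+1≡ a+a′≡ with k <? a | k′ <? a′
... | yes _   | no  _     = refl
... | no  _   | yes _     = refl
... | yes k<a | yes k′<a′ = ⊥-elim (<-irrefl refl (begin-strict
  Q                   ≡⟨ trans (sym k+k′+1≡) (+-comm _ 1) ⟩
  suc (k + k′)        <⟨ n<1+n _ ⟩
  suc (suc (k + k′))  ≡⟨ cong suc (sym (+-suc k k′)) ⟩
  suc k + suc k′      ≤⟨ +-mono-≤ k<a k′<a′ ⟩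
  a + a′              ≡⟨ a+a′≡ ⟩
  Q                   ∎))
  where open ≤-Reasoning
... | no  k≮a | no  k′≮a′ = ⊥-elim (<-irrefl refl (begin-strict
  Q             ≡⟨ sym a+a′≡ ⟩
  a + a′        ≤⟨ +-mono-≤ (≮⇒≥ k≮a) (≮⇒≥ k′≮a′) ⟩
  k + k′        <⟨ m<m+n (k + k′) z<s ⟩
  k + k′ + 1    ≡⟨ k+k′+1≡ ⟩
  Q             ∎))
  where open ≤-Reasoning

𝟙<-complement⁻¹ : ∀ {a a′} Q → a ≤ Q → a′ ≤ Q →
                  (∀ k → k < Q → 𝟙 (k <? a) + 𝟙 (Q ∸ suc k <? a′) ≡ 1) → a + a′ ≡ Q
𝟙<-complement⁻¹ {a} {a′} Q a≤Q a′≤Q pairs = begin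
  a + a′                                                     ≡⟨ sym (cong₂ _+_ (∑𝟙-<? Q a a≤Q) (∑𝟙-<? Q a′ a′≤Q)) ⟩
  ∑[ k < Q ] 𝟙 (k <? a) + ∑[ k < Q ] 𝟙 (k <? a′)             ≡⟨ cong (∑[ k < Q ] 𝟙 (k <? a) +_) (∑-reverse Q (λ k → 𝟙 (k <? a′))) ⟩
  ∑[ k < Q ] 𝟙 (k <? a) + ∑[ k < Q ] 𝟙 (Q ∸ suc k <? a′)     ≡⟨ sym (∑-distrib-+ Q _ _) ⟩
  ∑[ k < Q ] (𝟙 (k <? a) + 𝟙 (Q ∸ suc k <? a′))             ≡⟨ ∑-cong Q pairs ⟩
  ∑[ _ < Q ] 1                                               ≡⟨ ∑-one Q ⟩
  Q                                                          ∎
  where open ≡-Reasoning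

module Runners {t} .{{_ : NonZero t}} {xs} (xs↓ : Linked _≥_ xs) {m} (len≤m : length xs ≤ m) where
  open Abacus xs↓ len≤m

  runner : ℕ → ℕ
  runner r = ∑[ p < m ] 𝟙 ((bead p % t) ≟ r)

  private
    K : ℕ
    K = suc (bead 0)

    𝟙%≟ : ∀ {r v} → r < t → v < K → 𝟙 ((v % t) ≟ r) ≡ ∑[ k < K ] 𝟙 (v ≟ r + k * t)
    𝟙%≟ {r} {v} r<t v<K with (v % t) ≟ r
    ... | no  v%t≢r = sym (∑-zero K (λ k _ → 𝟙-no (v ≟ r + k * t)
                        (λ v≡ → v%t≢r (trans (cong (_% t) v≡) (trans ([m+kn]%n≡m%n r k t) (m<n⇒m%n≡m r<t))))))
    ... | yes v%t≡r = sym (trans (∑-cong K λ k _ → 𝟙-cong (v ≟ r + k * t) (k ≟ v / t) (mk⇔ quotient λ { refl → v≡ }))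
                                 (∑𝟙-≟ K (v / t) (≤-<-trans (m/n≤m v t) v<K)))
      where
      v≡ : v ≡ r + v / t * t
      v≡ = trans (m≡m%n+[m/n]*n v t) (cong (_+ v / t * t) v%t≡r)
      quotient : ∀ {k} → v ≡ r + k * t → k ≡ v / t
      quotient {k} v≡′ = *-cancelʳ-≡ k (v / t) t (+-cancelˡ-≡ r _ _ (trans (sym v≡′) v≡))

  runner≡∑beadAt : ∀ {r} → r < t → runner r ≡ ∑[ k < K ] beadAt (r + k * t)
  runner≡∑beadAt {r} r<t = trans (∑-cong m (λ p _ → 𝟙%≟ r<t (s≤s (bead-antitone z≤n))))
                                 (∑-comm m K (λ p k → 𝟙 (bead p ≟ r + k * t)))

  beadAt≡𝟙 : ∀ x → beadAt x ≡ 𝟙 (0 <? beadAt x)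
  beadAt≡𝟙 x with beadAt x | beadAt≤1 x
  ... | zero  | _       = refl
  ... | suc _ | s≤s z≤n = refl

  module _ (flush : ∀ x → 0 < beadAt (x + t) → 0 < beadAt x) where

    beadAt-runner : ∀ {r} → r < t → ∀ k → beadAt (r + k * t) ≡ 𝟙 (k <? runner r)
    beadAt-runner {r} r<t k =
      trans (beadAt≡𝟙 (r + k * t)) (𝟙-cong (0 <? beadAt (r + k * t)) (k <? runner r) (⇔-sym occupied⇔))
      where
      next : ∀ k → r + suc k * t ≡ r + k * t + t
      next k = solve 3 (λ r k t → r :+ (t :+ k :* t) := r :+ k :* t :+ t) refl r k t
      occupied⇔ : k < runner r ⇔ 0 < beadAt (r + k * t)
      occupied⇔ = subst (λ c → k < c ⇔ 0 < beadAt (r + k * t))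
                    (sym (trans (runner≡∑beadAt r<t) (∑-cong K (λ k _ → beadAt≡𝟙 (r + k * t)))))
        (<∑𝟙⇔ K (λ k → 0 <? beadAt (r + k * t))
          (λ k occ → flush (r + k * t) (subst (λ v → 0 < beadAt v) (next k) occ))
          (λ k K≤k occ → <-irrefl (sym (beadAt-beyond (≤-trans K≤k (≤-trans (m≤m*n k t) (m≤n+m _ r))))) occ) k)

+[∸1∸]+1≡ : ∀ {a T} → a < T → a + (T ∸ 1 ∸ a) + 1 ≡ T
+[∸1∸]+1≡ {a} {suc T} (s≤s a≤T) = trans (cong (_+ 1) (m+[n∸m]≡n a≤T)) (+-comm T 1)

∸1∸< : ∀ {t} r → 1 ≤ t → t ∸ 1 ∸ r < t
∸1∸< {suc t} r _ = s≤s (m∸n≤m t r)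

∸1∸-involutive : ∀ {t r} → r < t → t ∸ 1 ∸ (t ∸ 1 ∸ r) ≡ r
∸1∸-involutive {suc t} (s≤s r≤t) = m∸[m∸n]≡n r≤t

∸-<-half : ∀ a {r} → ¬ r ≤ a / 2 → a ∸ r ≤ a / 2
∸-<-half a {r} r≰h = m≤n+o⇒m∸n≤o a r (begin
  a                      ≡⟨ m≡m%n+[m/n]*n a 2 ⟩
  a % 2 + a / 2 * 2      ≤⟨ +-monoˡ-≤ (a / 2 * 2) (≤-pred (m%n<n a 2)) ⟩
  1 + a / 2 * 2          ≡⟨ solve 1 (λ h → con 1 :+ h :* con 2 := con 1 :+ h :+ h) refl (a / 2) ⟩
  suc (a / 2) + a / 2    ≤⟨ +-monoˡ-≤ (a / 2) (≰⇒> r≰h) ⟩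
  r + a / 2              ∎)
  where open ≤-Reasoning

module RunnerBalance {t} .{{_ : NonZero t}} (t≥1 : 1 ≤ t) {xs} (xs↓ : Linked _≥_ xs) {n M} (tn≡ : t * n ≡ suc M)
  (len≤m : length xs ≤ suc M) where
  open Abacus xs↓ len≤m
  open AbacusSymmetry xs↓ M len≤m using (ComplementSymmetric)
  open Runners xs↓ len≤m

  private
    m Q : ℕ
    m = suc M
    Q = 2 * n

    Qt≡ : Q * t ≡ m + m
    Qt≡ = trans (solve 2 (λ n t → (con 2 :* n) :* t := t :* n :+ t :* n) refl n t) (cong₂ _+_ tn≡ tn≡)

  RunnersBalanced : Set
  RunnersBalanced = ∀ i → i ≤ (t ∸ 1) / 2 → runner i + runner (t ∸ 1 ∸ i) ≡ Q

  all-runners-balanced : RunnersBalanced → ∀ r → r < t → runner r + runner (t ∸ 1 ∸ r) ≡ Q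
  all-runners-balanced balanced r r<t with r ≤? (t ∸ 1) / 2
  ... | yes r≤h = balanced r r≤h
  ... | no  r≰h = trans (+-comm (runner r) _)
                        (subst (λ v → runner (t ∸ 1 ∸ r) + runner v ≡ Q) (∸1∸-involutive r<t)
                               (balanced (t ∸ 1 ∸ r) (∸-<-half (t ∸ 1) r≰h)))

  positions-complement : ∀ i i′ k k′ → i + i′ + 1 ≡ t → k + k′ + 1 ≡ Q → (i + k * t) + (i′ + k′ * t) ≡ M + m
  positions-complement i i′ k k′ i+i′+1≡ k+k′+1≡ = +-cancelʳ-≡ (suc t) _ _ (begin
    i + k * t + (i′ + k′ * t) + suc t     ≡⟨ solve 5 (λ i i′ k k′ t → i :+ k :* t :+ (i′ :+ k′ :* t) :+ (con 1 :+ t)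
                                                  := (i :+ i′ :+ con 1) :+ (k :+ k′ :+ con 1) :* t) refl i i′ k k′ t ⟩
    (i + i′ + 1) + (k + k′ + 1) * t       ≡⟨ cong₂ (λ u v → u + v * t) i+i′+1≡ k+k′+1≡ ⟩
    t + Q * t                             ≡⟨ cong (t +_) Qt≡ ⟩
    t + (m + m)                           ≡⟨ solve 2 (λ t M → t :+ ((con 1 :+ M) :+ (con 1 :+ M)) := M :+ (con 1 :+ M) :+ (con 1 :+ t))
                                               refl t M ⟩
    M + m + suc t                         ∎)
    where open ≡-Reasoning

  module _ (flush : ∀ x → 0 < beadAt (x + t) → 0 < beadAt x) where
    private
      beadAt-runner′ : ∀ {r} → r < t → ∀ k → beadAt (r + k * t) ≡ 𝟙 (k <? runner r)
      beadAt-runner′ = beadAt-runner flush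

    complementSymmetric⇒runnersBalanced : ComplementSymmetric → RunnersBalanced
    complementSymmetric⇒runnersBalanced (pairs , empty) i i≤h =
      𝟙<-complement⁻¹ Q (runner≤Q i<t) (runner≤Q i′<t) λ k k<Q → begin
        𝟙 (k <? runner i) + 𝟙 (Q ∸ suc k <? runner i′)
          ≡⟨ sym (cong₂ _+_ (beadAt-runner′ i<t k) (beadAt-runner′ i′<t (Q ∸ suc k))) ⟩
        beadAt (i + k * t) + beadAt (i′ + (Q ∸ suc k) * t)
          ≡⟨ pairs _ _ (positions-complement i i′ k (Q ∸ suc k) (+[∸1∸]+1≡ i<t)
                          (trans (cong (λ v → k + v + 1) (sym (∸-+-assoc Q 1 k))) (+[∸1∸]+1≡ k<Q))) ⟩
        1 ∎
      where
      open ≡-Reasoning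
      i′ : ℕ
      i′ = t ∸ 1 ∸ i
      i<t : i < t
      i<t = ≤-<-trans i≤h (≤-<-trans (m/n≤m (t ∸ 1) 2) (∸1∸< 0 t≥1))
      i′<t : i′ < t
      i′<t = ∸1∸< i t≥1
      runner≤Q : ∀ {r} → r < t → runner r ≤ Q
      runner≤Q {r} r<t = ≮⇒≥ λ Q<runner → 0≢1+n (trans (sym (empty (r + Q * t) (subst (_≤ r + Q * t) Qt≡ (m≤n+m _ r))))
                                                        (trans (beadAt-runner′ r<t Q) (𝟙-yes (Q <? runner r) Q<runner)))

    runnersBalanced⇒complementSymmetric : RunnersBalanced → ComplementSymmetric
    runnersBalanced⇒complementSymmetric balanced = pairs , empty
      where
      x≡ : ∀ x → x ≡ x % t + x / t * t
      x≡ x = m≡m%n+[m/n]*n x t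
      beadAt≡ : ∀ x → beadAt x ≡ 𝟙 (x / t <? runner (x % t))
      beadAt≡ x = trans (cong beadAt (x≡ x)) (beadAt-runner′ (m%n<n x t) (x / t))
      runner≤Q : ∀ r → r < t → runner r ≤ Q
      runner≤Q r r<t = ≤-trans (m≤m+n (runner r) _) (≤-reflexive (all-runners-balanced balanced r r<t))
      pairs : ∀ x y → x + y ≡ M + m → beadAt x + beadAt y ≡ 1
      pairs x y x+y≡ = begin
        beadAt x + beadAt y                             ≡⟨ cong₂ _+_ (beadAt≡ x) (cong beadAt y≡) ⟩
        𝟙 (k <? runner r) + beadAt (r′ + k′ * t)        ≡⟨ cong (𝟙 (k <? runner r) +_) (beadAt-runner′ (∸1∸< r t≥1) k′) ⟩
        𝟙 (k <? runner r) + 𝟙 (k′ <? runner r′)         ≡⟨ 𝟙<-complement {a = runner r} (+[∸1∸]+1≡ k<Q) (all-runners-balanced balanced r r<t) ⟩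
        1                                               ∎
        where
        open ≡-Reasoning
        r k r′ k′ : ℕ
        r = x % t
        k = x / t
        r′ = t ∸ 1 ∸ r
        k′ = Q ∸ 1 ∸ k
        r<t : r < t
        r<t = m%n<n x t
        k<Q : k < Q
        k<Q = m<n*o⇒m/o<n (subst (x <_) (sym Qt≡) (≤-<-trans (≤-trans (m≤m+n x y) (≤-reflexive x+y≡)) (n<1+n (M + m))))
        y≡ : y ≡ r′ + k′ * t
        y≡ = +-cancelˡ-≡ x y _ (trans x+y≡ (sym (trans (cong (_+ (r′ + k′ * t)) (x≡ x))
                                                       (positions-complement r r′ k k′ (+[∸1∸]+1≡ r<t) (+[∸1∸]+1≡ k<Q)))))
      empty : ∀ x → m + m ≤ x → beadAt x ≡ 0
      empty x m+m≤x = trans (beadAt≡ x) (𝟙-no (x / t <? runner (x % t))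
                        (λ k<runner → <⇒≱ k<runner (≤-trans (runner≤Q (x % t) (m%n<n x t)) Q≤k)))
        where
        Q≤k : Q ≤ x / t
        Q≤k = ≮⇒≥ λ k<Q → <⇒≱ (begin-strict
          x                        ≡⟨ x≡ x ⟩
          x % t + x / t * t        <⟨ +-monoˡ-< (x / t * t) (m%n<n x t) ⟩
          t + x / t * t            ≤⟨ *-monoˡ-≤ t k<Q ⟩
          Q * t                    ≡⟨ Qt≡ ⟩
          m + m                    ∎) m+m≤x
          where open ≤-Reasoning

corollary3p3 : (t n : ℕ) → 2 ≤ t → 1 ≤ n → .{{_ : NonZero t}} →
    (λ′ κ : Partition) → IsPartition λ′ → len λ′ ≤ t * n →
    IsCoreOf t λ′ κ →
    (SelfConjugate κ ⇔
      (∀ i → i ≤ (t ∸ 1) / 2 →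
        nCount t i λ′ (t * n) + nCount t (t ∸ 1 ∸ i) λ′ (t * n) ≡ 2 * n))
corollary3p3 t n t>1 n≥1 λ′ κ λ-part len≤tn (strips , core)
  with t * n in tn≡ | *-mono-≤ (<⇒≤ t>1) n≥1 | removeStrips-invariant (<⇒≤ t>1) λ-part len≤tn strips
... | suc M | _ | (κ↓ , κ>0) , len≤m , same = mk⇔
  (λ sc i i≤h → trans (cong₂ _+_ (counts i) (counts (t ∸ 1 ∸ i)))
                      (complementSymmetric⇒runnersBalanced flush (to (selfConjugate⇔complementSymmetric κ>0) sc) i i≤h))
  (λ balanced → from (selfConjugate⇔complementSymmetric κ>0)
                  (runnersBalanced⇒complementSymmetric flush
                    (λ i i≤h → trans (sym (cong₂ _+_ (counts i) (counts (t ∸ 1 ∸ i)))) (balanced i i≤h))))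
  where
  open Abacus κ↓ len≤m using (beadAt)
  open AbacusSymmetry κ↓ M len≤m using (selfConjugate⇔complementSymmetric)
  open Runners κ↓ len≤m using (runner)
  open RunnerBalance (<⇒≤ t>1) κ↓ tn≡ len≤m
  flush : ∀ x → 0 < beadAt (x + t) → 0 < beadAt x
  flush = core⇒flush (<⇒≤ t>1) κ↓ len≤m core
  counts : ∀ i → nCount t i λ′ (suc M) ≡ runner i
  counts i = trans (same i) (nCount≡∑ t i κ (suc M))
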